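{- If an LCTRS $\mathcal{R}$ is almost development closed, then the TRS $\overline{\mathcal{R}}$ is almost development closed.
   Context: Logically constrained rewriting. Fix a many-sorted signature $\mathcal{F}=\mathcal{F}_{\mathrm{te}}\cup\mathcal{F}_{\mathrm{th}}$ (possibly infinite) and an infinite set $\mathcal{V}$ of sorted variables. For every sort $\iota$ of $\mathcal{F}_{\mathrm{th}}$ there is a non-empty set $\mathcal{V}\mathrm{al}_\iota\subseteq\mathcal{F}_{\mathrm{th}}$ of constants of sort $\iota$ (values); $\mathcal{V}\mathrm{al}=\bigcup_\iota\mathcal{V}\mathrm{al}_\iota$, $\mathcal{F}_{\mathrm{te}}\cap\mathcal{F}_{\mathrm{th}}\subseteq\mathcal{V}\mathrm{al}$. Logical terms are terms of $\mathcal{T}(\mathcal{F}_{\mathrm{th}},\mathcal{V})$; a fixed interpretation $\mathcal{J}$ evaluates ground logical terms to values via $[\![f(t_1,\dots,t_n)]\!]=f_{\mathcal{J}}([\![t_1]\!],\dots,[\![t_n]\!])$. Constraints are logical terms of sort $\mathsf{bool}$ (with connectives, $\Rightarrow$, equality $=$). $\varphi$ is valid if $[\![\varphi\gamma]\!]=\top$ for all $\gamma$ mapping $\mathcal{V}\mathrm{ar}(\varphi)$ to values, satisfiable if this holds for some such $\gamma$; $\sigma\vDash\varphi$ means $\sigma(x)\in\mathcal{V}\mathrm{al}$ for $x\in\mathcal{V}\mathrm{ar}(\varphi)$ and $\varphi\sigma$ valid. A constrained rewrite rule $\rho\colon\ell\to r\ [\varphi]$: $\ell,r$ terms of the same sort,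 $\mathrm{root}(\ell)\in\mathcal{F}_{\mathrm{te}}\setminus\mathcal{F}_{\mathrm{th}}$, $\varphi$ a constraint; $\mathcal{LV}\mathrm{ar}(\rho)=\mathcal{V}\mathrm{ar}(\varphi)\cup(\mathcal{V}\mathrm{ar}(r)\setminus\mathcal{V}\mathrm{ar}(\ell))$, $\mathcal{EV}\mathrm{ar}(\rho)=\mathcal{V}\mathrm{ar}(r)\setminus(\mathcal{V}\mathrm{ar}(\ell)\cup\mathcal{V}\mathrm{ar}(\varphi))$, $\mathcal{EC}_\rho=\bigwedge\{x=x\mid x\in\mathcal{EV}\mathrm{ar}(\rho)\}$. An LCTRS $\mathcal{R}$ is a set of such rules; calculation rules are $f(x_1,\dots,x_n)\to y\ [y=f(x_1,\dots,x_n)]$ for $f\in\mathcal{F}_{\mathrm{th}}\setminus\mathcal{V}\mathrm{al}$, $y$ fresh; $\mathcal{R}_{\mathrm{rc}}$ is $\mathcal{R}$ together with them. Constrained terms: pairs $s\ [\varphi]$. $s\ [\varphi]\sim t\ [\psi]$ iff for every $\gamma\vDash\varphi$ with $\mathcal{D}\mathrm{om}(\gamma)=\mathcal{V}\mathrm{ar}(\varphi)$ there is $\delta\vDash\psi$ with $\mathcal{D}\mathrm{om}(\delta)=\mathcal{V}\mathrm{ar}(\psi)$ and $s\gamma=t\delta$, and vice versa. $s\ [\varphi]\to s[r\sigma]_p\ [\varphi]$ if $s|_p=\ell\sigma$ for some $\rho\colon\ell\to r\ [\psi]\in\mathcal{R}_{\mathrm{rc}}$ with $\sigma(x)\in\mathcal{V}\mathrm{al}\cup\mathcal{V}\mathrm{ar}(\varphi)$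 for $x\in\mathcal{LV}\mathrm{ar}(\rho)$, $\varphi$ satisfiable and $\varphi\Rightarrow\psi\sigma$ valid; $\xrightarrow{\sim}={\sim}\cdot{\to}\cdot{\sim}$, $\xrightarrow{\sim}_{\geq q}$ requiring the step at a position $\geq q$. Multi-steps on constrained terms: $x\ [\varphi]\xrightarrow{\circ}x\ [\varphi]$; $f(s_1,\dots,s_n)\ [\varphi]\xrightarrow{\circ}f(t_1,\dots,t_n)\ [\varphi]$ if $s_i\ [\varphi]\xrightarrow{\circ}t_i\ [\varphi]$ for all $i$; $\ell\sigma\ [\varphi]\xrightarrow{\circ}r\tau\ [\varphi]$ if $\rho\colon\ell\to r\ [\psi]\in\mathcal{R}_{\mathrm{rc}}$, $\sigma(x)\in\mathcal{V}\mathrm{al}\cup\mathcal{V}\mathrm{ar}(\varphi)$ for $x\in\mathcal{LV}\mathrm{ar}(\rho)$, $\varphi$ satisfiable, $\varphi\Rightarrow\psi\sigma$ valid, and $\sigma(x)\ [\varphi]\xrightarrow{\circ}\tau(x)\ [\varphi]$ for all $x\in\mathcal{D}\mathrm{om}(\sigma)$; $\xrightarrow{\sim\circ}={\sim}\cdot\xrightarrow{\circ}\cdot{\sim}$, and $\xrightarrow{\sim\circ}_{\geq q}$ requires all contracted redexes at positions $\geq q$. An equation $s\approx t$ is treated as the term $\approx(s,t)$ for a fresh binary non-theory symbol (positions $1q$, $2q$ are position $q$ in $s$, $t$). $u\approx v\ [\psi]$ is trivial if $u\sigma=v\sigma$ for all $\sigma\vDash\psi$. Constrained critical pairs: for variable-disjoint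 variants $\rho_i\colon\ell_i\to r_i\ [\varphi_i]$ of rules in $\mathcal{R}_{\mathrm{rc}}$, a non-variable position $p$ of $\ell_2$, an mgu $\sigma$ of $\ell_1,\ell_2|_p$ with $\sigma(x)\in\mathcal{V}\mathrm{al}\cup\mathcal{V}$ for all $x\in\mathcal{LV}\mathrm{ar}(\rho_1)\cup\mathcal{LV}\mathrm{ar}(\rho_2)$, $\varphi_1\sigma\wedge\varphi_2\sigma$ satisfiable and (if $p=\epsilon$) $\rho_1,\rho_2$ not variants or $\mathcal{V}\mathrm{ar}(r_1)\not\subseteq\mathcal{V}\mathrm{ar}(\ell_1)$: the pair $\ell_2\sigma[r_1\sigma]_p\approx r_2\sigma\ [(\varphi_1\wedge\varphi_2\wedge\mathcal{EC}_{\rho_1}\wedge\mathcal{EC}_{\rho_2})\sigma]$, an overlay if $p=\epsilon$. It is almost development closed if either it is not an overlay and $s\approx t\ [\varphi]\xrightarrow{\sim\circ}_{\geq1}u\approx v\ [\psi]$ for some trivial $u\approx v\ [\psi]$, or it is an overlay and $s\approx t\ [\varphi]\xrightarrow{\sim\circ}_{\geq1}\cdot\xrightarrow{\sim}{}^*_{\geq2}u\approx v\ [\psi]$ for some trivial $u\approx v\ [\psi]$. $\mathcal{R}$ is almost development closed if all its constrained critical pairs are. The TRS $\overline{\mathcal{R}}$ consists of (1) $\ell\tau\to r\tau$ for every $\rho\colon\ell\to r\ [\varphi]\in\mathcal{R}$ and $\tau$ with $\mathcal{D}\mathrm{om}(\tau)=\mathcal{LV}\mathrm{ar}(\rho)$,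 $\tau(x)\in\mathcal{V}\mathrm{al}$ for $x\in\mathcal{LV}\mathrm{ar}(\rho)$ and $\varphi\tau$ valid, and (2) $f(v_1,\dots,v_n)\to[\![f(v_1,\dots,v_n)]\!]$ for $f\in\mathcal{F}_{\mathrm{th}}\setminus\mathcal{V}\mathrm{al}$ and values $v_i$. For a TRS: critical pairs are $\ell_2\sigma[r_1\sigma]_p\approx r_2\sigma$ for variable-disjoint variants $\ell_i\to r_i$ of rules, $p$ a non-variable position of $\ell_2$, $\sigma$ an mgu of $\ell_1,\ell_2|_p$, rules not variants if $p=\epsilon$ (an overlay if $p=\epsilon$). Multi-step $\xrightarrow{\circ}$: $x\xrightarrow{\circ}x$; $f(\vec s)\xrightarrow{\circ}f(\vec t)$ if $s_i\xrightarrow{\circ}t_i$; $\ell\sigma\xrightarrow{\circ}r\tau$ for a rule $\ell\to r$ if $\sigma(x)\xrightarrow{\circ}\tau(x)$ for all $x$. A critical pair $s\approx t$ is almost development closed if it is not an overlay and $s\xrightarrow{\circ}t$, or it is an overlay and $s\xrightarrow{\circ}\cdot\,{}^*\!\!\leftarrow t$; a TRS is almost development closed if all its critical pairs are. -}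

module Defs where

open import Data.Nat using (ℕ; zero; suc)
open import Data.List using (List; []; _∷_; _++_; map; filter)
open import Data.List.Membership.Propositional using (_∈_; _∉_)
open import Data.List.Relation.Unary.Unique.Propositional using (Unique)
open import Data.List.Relation.Binary.Pointwise using (Pointwise)
open import Data.Product using (Σ; ∃; _×_; _,_; Σ-syntax; ∃-syntax)
open import Data.Sum using (_⊎_)
open import Relation.Nullary using (¬_; ¬?)
open import Relation.Binary.PropositionalEquality using (_≡_; _≢_)
open import Relation.Binary.Definitions using (DecidableEquality)
open import Relation.Binary.Construct.Closure.ReflexiveTransitive using (Star)

-- The fixed setting: a many-sorted signature F = F_te ∪ F_th (possibly
-- infinite), an infinite set of sorted variables, values, and a fixed
-- interpretation J of the theory symbols (with the standard connectives
-- ∧, ⇒ and equality =).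

record Setting : Set₁ where
  field
    Sort Fun Var : Set
    _≟V_  : DecidableEquality Var
    vsort : Var → Sort
    -- infinitely many variables of every sort
    fresh : (ι : Sort) (xs : List Var) → Σ[ x ∈ Var ] (vsort x ≡ ι × x ∉ xs)
    arity : Fun → List Sort
    res   : Fun → Sort
    Te Th Val : Fun → Set
    te∪th   : ∀ f → Te f ⊎ Th f
    te∩th   : ∀ f → Te f → Th f → Val f
    val⊆th  : ∀ f → Val f → Th f
    val-const : ∀ f → Val f → arity f ≡ []
    -- every sort of F_th has a value
    val-nonempty : ∀ f ι → Th f → (res f ≡ ι ⊎ ι ∈ arity f) →
                   Σ[ v ∈ Fun ] (Val v × res v ≡ ι)
    fJ : Fun → List Fun → Fun
    fJ-val : ∀ v → Val v → fJ v [] ≡ v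
    fJ-closed : ∀ f vs → Th f → Pointwise (λ v ι → Val v × res v ≡ ι) vs (arity f) →
                Val (fJ f vs) × res (fJ f vs) ≡ res f
    bool : Sort
    top bot : Fun
    top-val : Val top
    bot-val : Val bot
    top-sort : res top ≡ bool
    bot-sort : res bot ≡ bool
    top≢bot : top ≢ bot
    bool-vals : ∀ v → Val v → res v ≡ bool → v ≡ top ⊎ v ≡ bot
    andF : Fun
    and-th : Th andF
    and-nv : ¬ Val andF
    and-ar : arity andF ≡ bool ∷ bool ∷ []
    and-res : res andF ≡ bool
    and-sem : ∀ a b → Val a → Val b → res a ≡ bool → res b ≡ bool →
              (fJ andF (a ∷ b ∷ []) ≡ top → a ≡ top × b ≡ top) ×
              (a ≡ top × b ≡ top → fJ andF (a ∷ b ∷ []) ≡ top)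
    impF : Fun
    imp-th : Th impF
    imp-nv : ¬ Val impF
    imp-ar : arity impF ≡ bool ∷ bool ∷ []
    imp-res : res impF ≡ bool
    imp-sem : ∀ a b → Val a → Val b → res a ≡ bool → res b ≡ bool →
              (fJ impF (a ∷ b ∷ []) ≡ top → a ≡ top → b ≡ top) ×
              ((a ≡ top → b ≡ top) → fJ impF (a ∷ b ∷ []) ≡ top)
    eqF : Sort → Fun
    eq-th : ∀ ι f → Th f → (res f ≡ ι ⊎ ι ∈ arity f) →
            Th (eqF ι) × ¬ Val (eqF ι) × arity (eqF ι) ≡ ι ∷ ι ∷ [] × res (eqF ι) ≡ bool
    eq-sem : ∀ ι a b → Val a → Val b → res a ≡ ι → res b ≡ ι →
             (fJ (eqF ι) (a ∷ b ∷ []) ≡ top → a ≡ b) ×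
             (a ≡ b → fJ (eqF ι) (a ∷ b ∷ []) ≡ top)

module Theory (S : Setting) where
  open Setting S
  open import Data.List.Membership.DecPropositional _≟V_ using (_∈?_)

  data Term : Set where
    var : Var → Term
    app : Fun → List Term → Term

  Subst : Set
  Subst = Var → Term

  infixl 30 _⟨_⟩ _⟨_⟩*
  mutual
    _⟨_⟩ : Term → Subst → Term
    var x ⟨ σ ⟩ = σ x
    app f ts ⟨ σ ⟩ = app f (ts ⟨ σ ⟩*)

    _⟨_⟩* : List Term → Subst → List Term
    [] ⟨ σ ⟩* = []
    (t ∷ ts) ⟨ σ ⟩* = t ⟨ σ ⟩ ∷ ts ⟨ σ ⟩*

  mutual
    vars : Term → List Var
    vars (var x) = x ∷ []
    vars (app f ts) = vars* ts

    vars* : List Term → List Var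
    vars* [] = []
    vars* (t ∷ ts) = vars t ++ vars* ts

  mutual
    data _∶_ : Term → Sort → Set where
      var∶ : ∀ x → var x ∶ vsort x
      app∶ : ∀ {f ts} → ts ∶* arity f → app f ts ∶ res f

    data _∶*_ : List Term → List Sort → Set where
      []  : [] ∶* []
      _∷_ : ∀ {t ts ι ιs} → t ∶ ι → ts ∶* ιs → (t ∷ ts) ∶* (ι ∷ ιs)

  WS : Subst → Set
  WS σ = ∀ x → σ x ∶ vsort x

  mutual
    data Logical : Term → Set where
      var : ∀ x → Logical (var x)
      app : ∀ {f ts} → Th f → Logical* ts → Logical (app f ts)

    data Logical* : List Term → Set where
      []  : Logical* []
      _∷_ : ∀ {t ts} → Logical t → Logical* ts → Logical* (t ∷ ts)

  Constraint : Term → Set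
  Constraint φ = Logical φ × φ ∶ bool

  data IsVal : Term → Set where
    val : ∀ {f} → Val f → IsVal (app f [])

  mutual
    data Eval : Term → Fun → Set where
      ev : ∀ {f ts vs} → Th f → Eval* ts vs → Eval (app f ts) (fJ f vs)

    data Eval* : List Term → List Fun → Set where
      []  : Eval* [] []
      _∷_ : ∀ {t ts v vs} → Eval t v → Eval* ts vs → Eval* (t ∷ ts) (v ∷ vs)

  ⊤ₜ : Term
  ⊤ₜ = app top []

  _∧ₜ_ : Term → Term → Term
  a ∧ₜ b = app andF (a ∷ b ∷ [])

  _⇒ₜ_ : Term → Term → Term
  a ⇒ₜ b = app impF (a ∷ b ∷ [])

  eqₜ : Sort → Term → Term → Term
  eqₜ ι a b = app (eqF ι) (a ∷ b ∷ [])

  ⋀ : List Term → Term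
  ⋀ [] = ⊤ₜ
  ⋀ (c ∷ cs) = c ∧ₜ ⋀ cs

  ValuedOn : Subst → List Var → Set
  ValuedOn γ xs = ∀ x → x ∈ xs → IsVal (γ x)

  Valid : Term → Set
  Valid φ = ∀ γ → WS γ → ValuedOn γ (vars φ) → Eval (φ ⟨ γ ⟩) top

  _⊨_ : Subst → Term → Set
  σ ⊨ φ = ValuedOn σ (vars φ) × Valid (φ ⟨ σ ⟩)

  Sat : Term → Set
  Sat φ = Σ[ γ ∈ Subst ] (WS γ × γ ⊨ φ)

  -- γ ⊨ φ with Dom(γ) = Var(φ)
  Inst : Term → Subst → Set
  Inst φ γ = WS γ × γ ⊨ φ × (∀ x → x ∉ vars φ → γ x ≡ var x)

  record Rule : Set where
    constructor _⟶_[_]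
    field lhs rhs con : Term
  open Rule public

  LV : Rule → Var → Set
  LV ρ x = x ∈ vars (con ρ) ⊎ (x ∈ vars (rhs ρ) × x ∉ vars (lhs ρ))

  EV : Rule → List Var
  EV ρ = filter (λ x → ¬? (x ∈? (vars (lhs ρ) ++ vars (con ρ)))) (vars (rhs ρ))

  EC : Rule → Term
  EC ρ = ⋀ (map (λ x → eqₜ (vsort x) (var x) (var x)) (EV ρ))

  ruleVars : Rule → List Var
  ruleVars ρ = vars (lhs ρ) ++ vars (rhs ρ) ++ vars (con ρ)

  data Calc : Rule → Set where
    calc : ∀ f xs y → Th f → ¬ Val f → Unique xs → y ∉ xs →
           Pointwise (λ x ι → vsort x ≡ ι) xs (arity f) → vsort y ≡ res f →
           Calc (app f (map var xs) ⟶ var y [ eqₜ (res f) (var y) (app f (map var xs)) ])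

  IsLCTRS : (Rule → Set) → Set
  IsLCTRS R = ∀ ρ → R ρ →
    (Σ[ ι ∈ Sort ] (lhs ρ ∶ ι × rhs ρ ∶ ι)) ×
    (Σ[ f ∈ Fun ] Σ[ ts ∈ List Term ] (lhs ρ ≡ app f ts × Te f × ¬ Th f)) ×
    Constraint (con ρ)

  record Renaming : Set where
    field
      π π⁻ : Var → Var
      inv₁ : ∀ x → π⁻ (π x) ≡ x
      inv₂ : ∀ x → π (π⁻ x) ≡ x
      sorted : ∀ x → vsort (π x) ≡ vsort x

  ren : Renaming → Subst
  ren π x = var (Renaming.π π x)

  Variant : Rule → Rule → Set
  Variant ρ ρ' = Σ[ π ∈ Renaming ]
    (lhs ρ' ≡ lhs ρ ⟨ ren π ⟩ × rhs ρ' ≡ rhs ρ ⟨ ren π ⟩ × con ρ' ≡ con ρ ⟨ ren π ⟩)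

  Disjoint : List Var → List Var → Set
  Disjoint xs ys = ∀ x → x ∈ xs → x ∉ ys

  MGU : Subst → Term → Term → Set
  MGU σ s t = WS σ × s ⟨ σ ⟩ ≡ t ⟨ σ ⟩ ×
    (∀ θ → WS θ → s ⟨ θ ⟩ ≡ t ⟨ θ ⟩ →
       Σ[ δ ∈ Subst ] (WS δ × (∀ x → θ x ≡ σ x ⟨ δ ⟩)))

  NonVar : Term → Set
  NonVar t = ∀ x → t ≢ var x

  -- positions: At p s a s' b  means  s|_p = a  and  s' = s[b]_p

  Pos : Set
  Pos = List ℕ

  mutual
    data At : Pos → Term → Term → Term → Term → Set where
      here : ∀ {s b} → At [] s s b b
      arg  : ∀ {i p f ts a ts' b} → At* i p ts a ts' b → At (i ∷ p) (app f ts) a (app f ts') b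

    data At* : ℕ → Pos → List Term → Term → List Term → Term → Set where
      hd : ∀ {p s a s' b ts} → At p s a s' b → At* zero p (s ∷ ts) a (s' ∷ ts) b
      tl : ∀ {i p s ts a ts' b} → At* i p ts a ts' b → At* (suc i) p (s ∷ ts) a (s ∷ ts') b

  module LCTRS (R : Rule → Set) where

    Rrc : Rule → Set
    Rrc ρ = R ρ ⊎ Calc ρ

    LVok : Term → Rule → Subst → Set
    LVok φ ρ σ = ∀ x → LV ρ x →
      IsVal (σ x) ⊎ Σ[ y ∈ Var ] (σ x ≡ var y × y ∈ vars φ)

    CStep : Term → Term → Term → Set
    CStep φ s t = Σ[ ρ ∈ Rule ] Σ[ σ ∈ Subst ] Σ[ p ∈ Pos ]
      (Rrc ρ × WS σ × At p s (lhs ρ ⟨ σ ⟩) t (rhs ρ ⟨ σ ⟩) ×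
       LVok φ ρ σ × Sat φ × Valid (φ ⇒ₜ (con ρ ⟨ σ ⟩)))

    mutual
      data MS (φ : Term) : Term → Term → Set where
        mvar  : ∀ x → MS φ (var x) (var x)
        mapp  : ∀ f {ss ts} → MS* φ ss ts → MS φ (app f ss) (app f ts)
        mrule : ∀ ρ σ τ → Rrc ρ → WS σ → LVok φ ρ σ → Sat φ →
                Valid (φ ⇒ₜ (con ρ ⟨ σ ⟩)) → (∀ x → MS φ (σ x) (τ x)) →
                MS φ (lhs ρ ⟨ σ ⟩) (rhs ρ ⟨ τ ⟩)

      data MS* (φ : Term) : List Term → List Term → Set where
        []  : MS* φ [] []
        _∷_ : ∀ {s t ss ts} → MS φ s t → MS* φ ss ts → MS* φ (s ∷ ss) (t ∷ ts)

    record CEq : Set where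
      constructor _≈_[_]
      field left right cstr : Term

    PSim : CEq → CEq → Set
    PSim (s ≈ t [ φ ]) (u ≈ v [ ψ ]) =
      (∀ γ → Inst φ γ → Σ[ δ ∈ Subst ] (Inst ψ δ × s ⟨ γ ⟩ ≡ u ⟨ δ ⟩ × t ⟨ γ ⟩ ≡ v ⟨ δ ⟩)) ×
      (∀ δ → Inst ψ δ → Σ[ γ ∈ Subst ] (Inst φ γ × s ⟨ γ ⟩ ≡ u ⟨ δ ⟩ × t ⟨ γ ⟩ ≡ v ⟨ δ ⟩))

    -- ~·→∘·~ with all redexes at positions ≥ 1 (i.e. inside the left side)
    MS≥1 : CEq → CEq → Set
    MS≥1 e e' = Σ[ s₁ ∈ Term ] Σ[ t₁ ∈ Term ] Σ[ φ₁ ∈ Term ] Σ[ s₂ ∈ Term ]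
      (PSim e (s₁ ≈ t₁ [ φ₁ ]) × MS φ₁ s₁ s₂ × PSim (s₂ ≈ t₁ [ φ₁ ]) e')

    -- ~·→·~ with the step at a position ≥ 2 (i.e. inside the right side)
    Step≥2 : CEq → CEq → Set
    Step≥2 e e' = Σ[ s₁ ∈ Term ] Σ[ t₁ ∈ Term ] Σ[ φ₁ ∈ Term ] Σ[ t₂ ∈ Term ]
      (PSim e (s₁ ≈ t₁ [ φ₁ ]) × CStep φ₁ t₁ t₂ × PSim (s₁ ≈ t₂ [ φ₁ ]) e')

    Trivial : CEq → Set
    Trivial (u ≈ v [ ψ ]) = ∀ σ → WS σ → σ ⊨ ψ → u ⟨ σ ⟩ ≡ v ⟨ σ ⟩

    record CCP (p : Pos) (e : CEq) : Set where
      field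
        ρ₁ ρ₂ ρ₁⁰ ρ₂⁰ : Rule
        ρ₁⁰∈ : Rrc ρ₁⁰
        ρ₂⁰∈ : Rrc ρ₂⁰
        var₁ : Variant ρ₁⁰ ρ₁
        var₂ : Variant ρ₂⁰ ρ₂
        disj : Disjoint (ruleVars ρ₁) (ruleVars ρ₂)
        u : Term
        u-at : At p (lhs ρ₂) u (lhs ρ₂) u
        u-nv : NonVar u
        σ : Subst
        mgu : MGU σ (lhs ρ₁) u
        σ-ok : ∀ x → LV ρ₁ x ⊎ LV ρ₂ x → IsVal (σ x) ⊎ Σ[ y ∈ Var ] (σ x ≡ var y)
        sat : Sat ((con ρ₁ ⟨ σ ⟩) ∧ₜ (con ρ₂ ⟨ σ ⟩))
        root : p ≡ [] → ¬ Variant ρ₁ ρ₂ ⊎ ¬ (∀ x → x ∈ vars (rhs ρ₁) → x ∈ vars (lhs ρ₁))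
        lft : At p (lhs ρ₂ ⟨ σ ⟩) (u ⟨ σ ⟩) (CEq.left e) (rhs ρ₁ ⟨ σ ⟩)
        rgt : CEq.right e ≡ rhs ρ₂ ⟨ σ ⟩
        cst : CEq.cstr e ≡ (con ρ₁ ∧ₜ (con ρ₂ ∧ₜ (EC ρ₁ ∧ₜ EC ρ₂))) ⟨ σ ⟩

    ADC-CP : Pos → CEq → Set
    ADC-CP p e =
      (p ≢ [] → Σ[ e' ∈ CEq ] (MS≥1 e e' × Trivial e')) ×
      (p ≡ [] → Σ[ e' ∈ CEq ] Σ[ e'' ∈ CEq ] (MS≥1 e e' × Star Step≥2 e' e'' × Trivial e''))

    AlmostDevClosed : Set
    AlmostDevClosed = ∀ p e → CCP p e → ADC-CP p e

    data Rbar : Term → Term → Set where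
      inst : ∀ ρ τ → R ρ →
             (∀ x → LV ρ x → IsVal (τ x) × τ x ∶ vsort x) →
             (∀ x → ¬ LV ρ x → τ x ≡ var x) →
             Valid (con ρ ⟨ τ ⟩) →
             Rbar (lhs ρ ⟨ τ ⟩) (rhs ρ ⟨ τ ⟩)
      calc : ∀ f vs → Th f → ¬ Val f →
             Pointwise (λ v ι → Val v × res v ≡ ι) vs (arity f) →
             Rbar (app f (map (λ v → app v []) vs)) (app (fJ f vs) [])

  module TRS (T : Term → Term → Set) where

    Step : Term → Term → Set
    Step s t = Σ[ ℓ ∈ Term ] Σ[ r ∈ Term ] Σ[ σ ∈ Subst ] Σ[ p ∈ Pos ]
      (T ℓ r × WS σ × At p s (ℓ ⟨ σ ⟩) t (r ⟨ σ ⟩))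

    mutual
      data MS : Term → Term → Set where
        mvar  : ∀ x → MS (var x) (var x)
        mapp  : ∀ f {ss ts} → MS* ss ts → MS (app f ss) (app f ts)
        mrule : ∀ ℓ r σ τ → T ℓ r → WS σ → (∀ x → MS (σ x) (τ x)) →
                MS (ℓ ⟨ σ ⟩) (r ⟨ τ ⟩)

      data MS* : List Term → List Term → Set where
        []  : MS* [] []
        _∷_ : ∀ {s t ss ts} → MS s t → MS* ss ts → MS* (s ∷ ss) (t ∷ ts)

    VariantT : Term → Term → Term → Term → Set
    VariantT ℓ r ℓ' r' = Σ[ π ∈ Renaming ] (ℓ' ≡ ℓ ⟨ ren π ⟩ × r' ≡ r ⟨ ren π ⟩)

    record CP (p : Pos) (s t : Term) : Set where
      field
        ℓ₁ r₁ ℓ₂ r₂ ℓ₁⁰ r₁⁰ ℓ₂⁰ r₂⁰ : Term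
        rule₁ : T ℓ₁⁰ r₁⁰
        rule₂ : T ℓ₂⁰ r₂⁰
        var₁ : VariantT ℓ₁⁰ r₁⁰ ℓ₁ r₁
        var₂ : VariantT ℓ₂⁰ r₂⁰ ℓ₂ r₂
        disj : Disjoint (vars ℓ₁ ++ vars r₁) (vars ℓ₂ ++ vars r₂)
        u : Term
        u-at : At p ℓ₂ u ℓ₂ u
        u-nv : NonVar u
        σ : Subst
        mgu : MGU σ ℓ₁ u
        root : p ≡ [] → ¬ VariantT ℓ₁ r₁ ℓ₂ r₂
        lft : At p (ℓ₂ ⟨ σ ⟩) (u ⟨ σ ⟩) s (r₁ ⟨ σ ⟩)
        rgt : t ≡ r₂ ⟨ σ ⟩

    AlmostDevClosed : Set
    AlmostDevClosed = ∀ p s t → CP p s t →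
      (p ≢ [] → MS s t) ×
      (p ≡ [] → Σ[ w ∈ Term ] (MS s w × Star Step t w))

module Submission where

-- A critical pair of R̄ overlaps two instances ℓ₁τ₁ → r₁τ₁ and ℓ₂τ₂ → r₂τ₂ of rules of
-- R_rc, where the τᵢ send logical variables to values satisfying the constraints and
-- leave all other variables alone.  Renaming the two rules apart, the substitution α
-- that performs both instantiations turns ℓ₁ and the overlapped subterm of ℓ₂ into the
-- two sides of the TRS overlap; as the image of α consists of values and variables, the
-- overlap already happens at a non-variable position of ℓ₂ and ℓ₁, ℓ₂|ₚ are unifiable
-- with an mgu σ′ through which the TRS unifier factors.  This gives a constrained critical
-- pair whose constraint is solved by the TRS unifier, so the TRS critical pair is one of
-- its instances.  Finally, instances of constrained (multi-)steps by solutions of the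
-- constraint are (multi-)steps of R̄, and instances of trivial equations are identities,
-- so the closing sequences of the constrained pair instantiate to closing sequences.

open import Defs
open import Data.Nat using (ℕ; zero; suc; _+_; _≤_)
open import Data.Nat.Properties using (<⇒≤; ≤-trans; ≤-refl; +-suc; +-assoc; +-comm; m≤m+n; m≤n+m; ≤-pred; m≤n⇒m≤1+n; <-irrefl)
open import Data.List using (List; []; _∷_; _++_; map; filter; length)
open import Data.List.Properties using (∷-injective; filter-notAll)
open import Data.List.Membership.Propositional using (_∈_; _∉_)
open import Data.List.Relation.Binary.Subset.Propositional using (_⊆_)
open import Data.List.Membership.Propositional.Properties using (∈-++⁺ˡ; ∈-++⁺ʳ; ∈-++⁻; ∈-filter⁺; ∈-filter⁻; ∈-map⁺)
open import Data.List.Relation.Unary.Any using (here; there)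
import Data.List.Relation.Unary.Any as Any
import Data.List.Relation.Unary.All as All
open import Data.List.Relation.Unary.Unique.Propositional using (Unique)
open import Data.List.Relation.Unary.AllPairs using ([]; _∷_)
open import Data.List.Relation.Binary.Pointwise using (Pointwise; []; _∷_)
open import Data.Product using (_×_; _,_; proj₁; proj₂; map₂; Σ-syntax)
open import Data.Sum using (_⊎_; inj₁; inj₂)
import Data.Sum as Sum
open import Data.Unit using (⊤; tt)
open import Data.Empty using (⊥; ⊥-elim)
open import Relation.Nullary using (¬_; Dec; yes; no; ¬?)
open import Relation.Binary.PropositionalEquality using (_≡_; _≢_; refl; sym; trans; cong; cong₂; subst; subst₂; module ≡-Reasoning)
open import Relation.Binary.Construct.Closure.ReflexiveTransitive using (Star; ε; _◅_)

module _ (S : Setting) where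
  open Setting S
  open Theory S
  open import Data.List.Membership.DecPropositional _≟V_ using (_∈?_)
  open import Data.List.Relation.Binary.Subset.DecPropositional _≟V_ using (_⊆?_)

  infixl 30 _⨾_
  _⨾_ : Subst → Subst → Subst
  (σ ⨾ θ) x = σ x ⟨ θ ⟩

  Closed : Term → Set
  Closed t = ∀ x → x ∉ vars t

  app-injective : ∀ {f g} {ts us : List Term} → app f ts ≡ app g us → f ≡ g × ts ≡ us
  app-injective refl = refl , refl

  mutual
    ⟨⟩-cong-on : ∀ t {σ θ} → (∀ x → x ∈ vars t → σ x ≡ θ x) → t ⟨ σ ⟩ ≡ t ⟨ θ ⟩
    ⟨⟩-cong-on (var x) h = h x (here refl)
    ⟨⟩-cong-on (app f ts) h = cong (app f) (⟨⟩*-cong-on ts h)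

    ⟨⟩*-cong-on : ∀ ts {σ θ} → (∀ x → x ∈ vars* ts → σ x ≡ θ x) → ts ⟨ σ ⟩* ≡ ts ⟨ θ ⟩*
    ⟨⟩*-cong-on [] h = refl
    ⟨⟩*-cong-on (t ∷ ts) h = cong₂ _∷_ (⟨⟩-cong-on t (λ x m → h x (∈-++⁺ˡ m)))
                                       (⟨⟩*-cong-on ts (λ x m → h x (∈-++⁺ʳ (vars t) m)))

  ⟨⟩-cong : ∀ t {σ θ} → (∀ x → σ x ≡ θ x) → t ⟨ σ ⟩ ≡ t ⟨ θ ⟩
  ⟨⟩-cong t h = ⟨⟩-cong-on t (λ x _ → h x)

  mutual
    ⟨⟩-agree : ∀ t {σ θ} → t ⟨ σ ⟩ ≡ t ⟨ θ ⟩ → ∀ x → x ∈ vars t → σ x ≡ θ x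
    ⟨⟩-agree (var y) e x (here refl) = e
    ⟨⟩-agree (app f ts) e x m = ⟨⟩*-agree ts (proj₂ (app-injective e)) x m

    ⟨⟩*-agree : ∀ ts {σ θ} → ts ⟨ σ ⟩* ≡ ts ⟨ θ ⟩* → ∀ x → x ∈ vars* ts → σ x ≡ θ x
    ⟨⟩*-agree (t ∷ ts) e x m with ∈-++⁻ (vars t) m
    ... | inj₁ m' = ⟨⟩-agree t (proj₁ (∷-injective e)) x m'
    ... | inj₂ m' = ⟨⟩*-agree ts (proj₂ (∷-injective e)) x m'

  mutual
    ⟨⟩-⨾ : ∀ t {σ θ} → t ⟨ σ ⟩ ⟨ θ ⟩ ≡ t ⟨ σ ⨾ θ ⟩
    ⟨⟩-⨾ (var x) = refl
    ⟨⟩-⨾ (app f ts) = cong (app f) (⟨⟩*-⨾ ts)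

    ⟨⟩*-⨾ : ∀ ts {σ θ} → ts ⟨ σ ⟩* ⟨ θ ⟩* ≡ ts ⟨ σ ⨾ θ ⟩*
    ⟨⟩*-⨾ [] = refl
    ⟨⟩*-⨾ (t ∷ ts) = cong₂ _∷_ (⟨⟩-⨾ t) (⟨⟩*-⨾ ts)

  mutual
    ⟨⟩-identity : ∀ t → t ⟨ var ⟩ ≡ t
    ⟨⟩-identity (var x) = refl
    ⟨⟩-identity (app f ts) = cong (app f) (⟨⟩*-identity ts)

    ⟨⟩*-identity : ∀ ts → ts ⟨ var ⟩* ≡ ts
    ⟨⟩*-identity [] = refl
    ⟨⟩*-identity (t ∷ ts) = cong₂ _∷_ (⟨⟩-identity t) (⟨⟩*-identity ts)

  mutual
    ∈-vars-⟨⟩⁻ : ∀ t {σ z} → z ∈ vars (t ⟨ σ ⟩) → Σ[ x ∈ Var ] (x ∈ vars t × z ∈ vars (σ x))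
    ∈-vars-⟨⟩⁻ (var x) m = x , here refl , m
    ∈-vars-⟨⟩⁻ (app f ts) m = ∈-vars-⟨⟩*⁻ ts m

    ∈-vars-⟨⟩*⁻ : ∀ ts {σ z} → z ∈ vars* (ts ⟨ σ ⟩*) → Σ[ x ∈ Var ] (x ∈ vars* ts × z ∈ vars (σ x))
    ∈-vars-⟨⟩*⁻ (t ∷ ts) {σ} m with ∈-++⁻ (vars (t ⟨ σ ⟩)) m
    ... | inj₁ m' with ∈-vars-⟨⟩⁻ t m'
    ...   | x , a , b = x , ∈-++⁺ˡ a , b
    ∈-vars-⟨⟩*⁻ (t ∷ ts) {σ} m | inj₂ m' with ∈-vars-⟨⟩*⁻ ts m'
    ...   | x , a , b = x , ∈-++⁺ʳ (vars t) a , b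

  mutual
    ∈-vars-⟨⟩⁺ : ∀ t {σ z x} → x ∈ vars t → z ∈ vars (σ x) → z ∈ vars (t ⟨ σ ⟩)
    ∈-vars-⟨⟩⁺ (var y) (here refl) m = m
    ∈-vars-⟨⟩⁺ (app f ts) a m = ∈-vars-⟨⟩*⁺ ts a m

    ∈-vars-⟨⟩*⁺ : ∀ ts {σ z x} → x ∈ vars* ts → z ∈ vars (σ x) → z ∈ vars* (ts ⟨ σ ⟩*)
    ∈-vars-⟨⟩*⁺ (t ∷ ts) {σ} a m with ∈-++⁻ (vars t) a
    ... | inj₁ a' = ∈-++⁺ˡ (∈-vars-⟨⟩⁺ t a' m)
    ... | inj₂ a' = ∈-++⁺ʳ (vars (t ⟨ σ ⟩)) (∈-vars-⟨⟩*⁺ ts a' m)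

  ∈-vars-app₂⁻ : ∀ {f} a b {x} → x ∈ vars (app f (a ∷ b ∷ [])) → x ∈ vars a ⊎ x ∈ vars b
  ∈-vars-app₂⁻ a b m with ∈-++⁻ (vars a) m
  ... | inj₁ ma = inj₁ ma
  ... | inj₂ m′ with ∈-++⁻ (vars b) m′
  ...   | inj₁ mb = inj₂ mb

  ∈-vars-∧⁻ : ∀ a b {x} → x ∈ vars (a ∧ₜ b) → x ∈ vars a ⊎ x ∈ vars b
  ∈-vars-∧⁻ = ∈-vars-app₂⁻ {andF}

  ∈-vars-⇒⁻ : ∀ a b {x} → x ∈ vars (a ⇒ₜ b) → x ∈ vars a ⊎ x ∈ vars b
  ∈-vars-⇒⁻ = ∈-vars-app₂⁻ {impF}

  ⟨⟩-closed : ∀ t {σ} → Closed t → t ⟨ σ ⟩ ≡ t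
  ⟨⟩-closed t h = trans (⟨⟩-cong-on t (λ x m → ⊥-elim (h x m))) (⟨⟩-identity t)

  IsVal-closed : ∀ {t} → IsVal t → Closed t
  IsVal-closed (val _) x ()

  IsVal-⟨⟩ : ∀ {t σ} → IsVal t → t ⟨ σ ⟩ ≡ t
  IsVal-⟨⟩ {t} v = ⟨⟩-closed t (IsVal-closed v)

  IsVal-stable : ∀ {t σ} → IsVal t → IsVal (t ⟨ σ ⟩)
  IsVal-stable v = subst IsVal (sym (IsVal-⟨⟩ v)) v

  ValuedOn-closed : ∀ t {γ} → ValuedOn γ (vars t) → Closed (t ⟨ γ ⟩)
  ValuedOn-closed t h x m with ∈-vars-⟨⟩⁻ t m
  ... | y , a , b = IsVal-closed (h y a) x b

  mutual
    ∶-⟨⟩ : ∀ {t ι σ} → WS σ → t ∶ ι → t ⟨ σ ⟩ ∶ ι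
    ∶-⟨⟩ ws (var∶ x) = ws x
    ∶-⟨⟩ ws (app∶ d) = app∶ (∶*-⟨⟩ ws d)

    ∶*-⟨⟩ : ∀ {ts ιs σ} → WS σ → ts ∶* ιs → ts ⟨ σ ⟩* ∶* ιs
    ∶*-⟨⟩ ws [] = []
    ∶*-⟨⟩ ws (d ∷ ds) = ∶-⟨⟩ ws d ∷ ∶*-⟨⟩ ws ds

  ∶-unique : ∀ {t ι ι'} → t ∶ ι → t ∶ ι' → ι ≡ ι'
  ∶-unique (var∶ x) (var∶ .x) = refl
  ∶-unique (app∶ _) (app∶ _) = refl

  WS-var : WS var
  WS-var = var∶

  WS-⨾ : ∀ {σ θ} → WS σ → WS θ → WS (σ ⨾ θ)
  WS-⨾ wσ wθ x = ∶-⟨⟩ wθ (wσ x)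

  ⌜_⌝ : Fun → Term
  ⌜ v ⌝ = app v []

  ValOfSort : Fun → Sort → Set
  ValOfSort v ι = Val v × res v ≡ ι

  IsVal-inv : ∀ {t} → IsVal t → Σ[ v ∈ Fun ] (t ≡ ⌜ v ⌝ × Val v)
  IsVal-inv (val {v} vv) = v , refl , vv

  ⌜⌝-sort : ∀ {v ι} → ⌜ v ⌝ ∶ ι → res v ≡ ι
  ⌜⌝-sort (app∶ _) = refl

  ⌜⌝-∶ : ∀ {v} → Val v → ⌜ v ⌝ ∶ res v
  ⌜⌝-∶ {v} vv = app∶ (subst (_ ∶*_) (sym (val-const v vv)) [])

  mutual
    Eval-functional : ∀ {t v w} → Eval t v → Eval t w → v ≡ w
    Eval-functional (ev _ es) (ev _ es') = cong (fJ _) (Eval*-functional es es')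

    Eval*-functional : ∀ {ts vs ws} → Eval* ts vs → Eval* ts ws → vs ≡ ws
    Eval*-functional [] [] = refl
    Eval*-functional (e ∷ es) (e' ∷ es') = cong₂ _∷_ (Eval-functional e e') (Eval*-functional es es')

  mutual
    Eval-sort : ∀ {t v ι} → Eval t v → t ∶ ι → ValOfSort v ι
    Eval-sort (ev th es) (app∶ d) = fJ-closed _ _ th (Eval*-sort es d)

    Eval*-sort : ∀ {ts vs ιs} → Eval* ts vs → ts ∶* ιs → Pointwise ValOfSort vs ιs
    Eval*-sort [] [] = []
    Eval*-sort (e ∷ es) (d ∷ ds) = Eval-sort e d ∷ Eval*-sort es ds

  Eval-⌜⌝ : ∀ {v} → Val v → Eval ⌜ v ⌝ v
  Eval-⌜⌝ {v} vv = subst (Eval ⌜ v ⌝) (fJ-val v vv) (ev (val⊆th v vv) [])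

  Eval*-⌜⌝ : ∀ {vs ιs} → Pointwise ValOfSort vs ιs → Eval* (map ⌜_⌝ vs) vs
  Eval*-⌜⌝ [] = []
  Eval*-⌜⌝ ((vv , _) ∷ q) = Eval-⌜⌝ vv ∷ Eval*-⌜⌝ q

  ⌜⌝*-closed : ∀ vs z → z ∉ vars* (map ⌜_⌝ vs)
  ⌜⌝*-closed [] z ()
  ⌜⌝*-closed (v ∷ vs) z m = ⌜⌝*-closed vs z m

  Closed⇒Valid : ∀ t → Closed t → Eval t top → Valid t
  Closed⇒Valid t h e γ _ _ = subst (λ u → Eval u top) (sym (⟨⟩-closed t h)) e

  Valid⇒Eval : ∀ t → Closed t → Valid t → Eval t top
  Valid⇒Eval t h v = subst (λ u → Eval u top) (⟨⟩-closed t h) (v var WS-var (λ x m → ⊥-elim (h x m)))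

  -- The value is kept as an index w with w ≡ top: matching on ev cannot solve fJ f vs ≟ top.
  Eval-⇒-elim : ∀ {a b w} → Eval (a ⇒ₜ b) w → w ≡ top → Eval a top →
                (∀ {u} → Eval b u → ValOfSort u bool) → Eval b top
  Eval-⇒-elim (ev _ (ea ∷ eb ∷ [])) w≡⊤ ea' b-bool with Eval-functional ea ea'
  ... | refl = subst (Eval _) (proj₁ (imp-sem top _ top-val (proj₁ (b-bool eb)) top-sort (proj₂ (b-bool eb))) w≡⊤ refl) eb

  Eval-∧-intro : ∀ {a b} → Eval a top → Eval b top → Eval (a ∧ₜ b) top
  Eval-∧-intro ea eb = subst (Eval _) (proj₂ (and-sem top top top-val top-val top-sort top-sort) (refl , refl))
                                      (ev and-th (ea ∷ eb ∷ []))

  Eval-eq-refl : ∀ {t ι} → IsVal t → t ∶ ι → Eval (eqₜ ι t t) top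
  Eval-eq-refl {ι = ι} (val {v} vv) d =
    subst (Eval _) (proj₂ (eq-sem ι v v vv vv r r) refl)
      (ev (proj₁ (eq-th ι v (val⊆th v vv) (inj₁ r))) (Eval-⌜⌝ vv ∷ Eval-⌜⌝ vv ∷ []))
    where r = ⌜⌝-sort d

  Eval-eq-elim : ∀ {ι s t w a b} → Eval (eqₜ ι s t) w → w ≡ top → Eval s a → Eval t b →
                 ValOfSort a ι → ValOfSort b ι → a ≡ b
  Eval-eq-elim {ι} (ev _ (es ∷ et ∷ [])) w≡⊤ es' et' (a-val , a-sort) (b-val , b-sort)
    with Eval-functional es es' | Eval-functional et et'
  ... | refl | refl = proj₁ (eq-sem ι _ _ a-val b-val a-sort b-sort) w≡⊤

  mutual
    At-⟨⟩ : ∀ {p s a s' b σ} → At p s a s' b → At p (s ⟨ σ ⟩) (a ⟨ σ ⟩) (s' ⟨ σ ⟩) (b ⟨ σ ⟩)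
    At-⟨⟩ here = here
    At-⟨⟩ (arg x) = arg (At*-⟨⟩ x)

    At*-⟨⟩ : ∀ {i p ts a ts' b σ} → At* i p ts a ts' b → At* i p (ts ⟨ σ ⟩*) (a ⟨ σ ⟩) (ts' ⟨ σ ⟩*) (b ⟨ σ ⟩)
    At*-⟨⟩ (hd x) = hd (At-⟨⟩ x)
    At*-⟨⟩ (tl x) = tl (At*-⟨⟩ x)

  mutual
    At-replace : ∀ {p s a s' b} → At p s a s' b → ∀ c → Σ[ s'' ∈ Term ] At p s a s'' c
    At-replace here c = c , here
    At-replace (arg {f = f} x) c with At*-replace x c
    ... | ts , y = app f ts , arg y

    At*-replace : ∀ {i p ts a ts' b} → At* i p ts a ts' b → ∀ c → Σ[ ts'' ∈ List Term ] At* i p ts a ts'' c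
    At*-replace (hd {ts = ts} x) c with At-replace x c
    ... | s , y = (s ∷ ts) , hd y
    At*-replace (tl {s = s} x) c with At*-replace x c
    ... | ts , y = (s ∷ ts) , tl y

  mutual
    At-functional : ∀ {p s a a' s' s'' b} → At p s a s' b → At p s a' s'' b → s' ≡ s''
    At-functional here here = refl
    At-functional (arg {f = f} x) (arg y) = cong (app f) (At*-functional x y)

    At*-functional : ∀ {i p ts a a' ts' ts'' b} → At* i p ts a ts' b → At* i p ts a' ts'' b → ts' ≡ ts''
    At*-functional (hd {ts = ts} x) (hd y) = cong (_∷ ts) (At-functional x y)
    At*-functional (tl {s = s} x) (tl y) = cong (s ∷_) (At*-functional x y)

  mutual
    At-sort : ∀ {p s a s' b ι} → At p s a s' b → s ∶ ι → Σ[ ι' ∈ Sort ] a ∶ ι'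
    At-sort here d = _ , d
    At-sort (arg x) (app∶ d) = At*-sort x d

    At*-sort : ∀ {i p ts a ts' b ιs} → At* i p ts a ts' b → ts ∶* ιs → Σ[ ι' ∈ Sort ] a ∶ ι'
    At*-sort (hd x) (d ∷ _) = At-sort x d
    At*-sort (tl x) (_ ∷ ds) = At*-sort x ds

  mutual
    At-⟨⟩⁻ : ∀ {p} t {α u s' b} → At p (t ⟨ α ⟩) u s' b →
      (Σ[ u' ∈ Term ] (At p t u' t u' × u ≡ u' ⟨ α ⟩)) ⊎
      (Σ[ x ∈ Var ] Σ[ q ∈ Pos ] Σ[ s'' ∈ Term ] (x ∈ vars t × At q (α x) u s'' b))
    At-⟨⟩⁻ (var x) at = inj₂ (x , _ , _ , here refl , at)
    At-⟨⟩⁻ (app f ts) here = inj₁ (app f ts , here , refl)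
    At-⟨⟩⁻ (app f ts) (arg x) with At*-⟨⟩⁻ ts x
    ... | inj₁ (u' , y , e) = inj₁ (u' , arg y , e)
    ... | inj₂ r = inj₂ r

    At*-⟨⟩⁻ : ∀ {i p} ts {α u ts' b} → At* i p (ts ⟨ α ⟩*) u ts' b →
      (Σ[ u' ∈ Term ] (At* i p ts u' ts u' × u ≡ u' ⟨ α ⟩)) ⊎
      (Σ[ x ∈ Var ] Σ[ q ∈ Pos ] Σ[ s'' ∈ Term ] (x ∈ vars* ts × At q (α x) u s'' b))
    At*-⟨⟩⁻ (t ∷ ts) (hd x) with At-⟨⟩⁻ t x
    ... | inj₁ (u' , y , e) = inj₁ (u' , hd y , e)
    ... | inj₂ (z , q , s'' , m , y) = inj₂ (z , q , s'' , ∈-++⁺ˡ m , y)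
    At*-⟨⟩⁻ (t ∷ ts) (tl x) with At*-⟨⟩⁻ ts x
    ... | inj₁ (u' , y , e) = inj₁ (u' , tl y , e)
    ... | inj₂ (z , q , s'' , m , y) = inj₂ (z , q , s'' , ∈-++⁺ʳ (vars t) m , y)

  At-cong : ∀ {p s s' a a' t b b'} → s ≡ s' → a ≡ a' → b ≡ b' → At p s a t b → At p s' a' t b'
  At-cong refl refl refl at = at

  At-⌜⌝ : ∀ {q v u s b} → At q ⌜ v ⌝ u s b → u ≡ ⌜ v ⌝
  At-⌜⌝ here = refl
  At-⌜⌝ (arg ())

  At-var : ∀ {q y u s b} → At q (var y) u s b → u ≡ var y
  At-var here = refl

  At-root : ∀ {s a s' b} → At [] s a s' b → a ≡ s
  At-root here = refl

  open Renaming

  idʳ : Renaming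
  idʳ = record { π = λ x → x ; π⁻ = λ x → x ; inv₁ = λ _ → refl ; inv₂ = λ _ → refl ; sorted = λ _ → refl }

  infixl 30 _⨾ʳ_
  _⨾ʳ_ : Renaming → Renaming → Renaming
  P ⨾ʳ Q = record
    { π = λ x → π Q (π P x) ; π⁻ = λ x → π⁻ P (π⁻ Q x)
    ; inv₁ = λ x → trans (cong (π⁻ P) (inv₁ Q (π P x))) (inv₁ P x)
    ; inv₂ = λ x → trans (cong (π Q) (inv₂ P (π⁻ Q x))) (inv₂ Q x)
    ; sorted = λ x → trans (sorted Q (π P x)) (sorted P x) }

  infix 40 _⁻¹ʳ
  _⁻¹ʳ : Renaming → Renaming
  P ⁻¹ʳ = record { π = π⁻ P ; π⁻ = π P ; inv₁ = inv₂ P ; inv₂ = inv₁ P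
                 ; sorted = λ x → trans (sym (sorted P (π⁻ P x))) (cong vsort (inv₂ P x)) }

  swap : Var → Var → Var → Var
  swap a b x with x ≟V a
  ... | yes _ = b
  ... | no _ with x ≟V b
  ...   | yes _ = a
  ...   | no _ = x

  swap-a : ∀ a b → swap a b a ≡ b
  swap-a a b with a ≟V a
  ... | yes _ = refl
  ... | no a≢a = ⊥-elim (a≢a refl)

  swap-b : ∀ a b → swap a b b ≡ a
  swap-b a b with b ≟V a
  ... | yes refl = refl
  ... | no _ with b ≟V b
  ...   | yes _ = refl
  ...   | no b≢b = ⊥-elim (b≢b refl)

  swap-other : ∀ a b x → x ≢ a → x ≢ b → swap a b x ≡ x
  swap-other a b x x≢a x≢b with x ≟V a
  ... | yes e = ⊥-elim (x≢a e)
  ... | no _ with x ≟V b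
  ...   | yes e = ⊥-elim (x≢b e)
  ...   | no _ = refl

  swap-involutive : ∀ a b x → swap a b (swap a b x) ≡ x
  swap-involutive a b x with x ≟V a
  ... | yes refl = swap-b a b
  ... | no x≢a with x ≟V b
  ...   | yes refl = swap-a a b
  ...   | no x≢b = swap-other a b x x≢a x≢b

  swap-sorted : ∀ a b → vsort a ≡ vsort b → ∀ x → vsort (swap a b x) ≡ vsort x
  swap-sorted a b e x with x ≟V a
  ... | yes refl = sym e
  ... | no _ with x ≟V b
  ...   | yes refl = e
  ...   | no _ = refl

  swapʳ : (a b : Var) → vsort a ≡ vsort b → Renaming
  swapʳ a b e = record { π = swap a b ; π⁻ = swap a b
                       ; inv₁ = swap-involutive a b ; inv₂ = swap-involutive a b
                       ; sorted = swap-sorted a b e }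

  -- Each variable of X that lands in A is swapped with a fresh variable of its sort.
  fresh-renaming : (X A : List Var) → Σ[ P ∈ Renaming ] (∀ x → x ∈ X → π P x ∉ A)
  fresh-renaming [] A = idʳ , λ _ ()
  fresh-renaming (x ∷ X) A with fresh-renaming X A
  ... | P , away with π P x ∈? A
  ...   | no x∉A = P , λ { y (here refl) → x∉A ; y (there m) → away y m }
  ...   | yes x∈A with fresh (vsort (π P x)) (A ++ map (π P) X)
  ...     | z , z-sort , z-new = P ⨾ʳ swapʳ (π P x) z (sym z-sort) , away′
    where
    away′ : ∀ y → y ∈ x ∷ X → swap (π P x) z (π P y) ∉ A
    away′ y (here refl) rewrite swap-a (π P x) z = λ m → z-new (∈-++⁺ˡ m)
    away′ y (there m) = avoid (π P y ≟V π P x) (π P y ≟V z)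
      where
      avoid : Dec (π P y ≡ π P x) → Dec (π P y ≡ z) → swap (π P x) z (π P y) ∉ A
      avoid (yes e) _ = ⊥-elim (away y m (subst (_∈ A) (sym e) x∈A))
      avoid (no _) (yes e) = ⊥-elim (z-new (∈-++⁺ʳ A (subst (_∈ map (π P) X) e (∈-map⁺ (π P) m))))
      avoid (no ne) (no nz) = subst (_∉ A) (sym (swap-other (π P x) z (π P y) ne nz)) (away y m)

  WS-ren : ∀ P → WS (ren P)
  WS-ren P x = subst (var (π P x) ∶_) (sorted P x) (var∶ (π P x))

  ∈-vars-ren⁺ : ∀ {P t x} → x ∈ vars t → π P x ∈ vars (t ⟨ ren P ⟩)
  ∈-vars-ren⁺ {t = t} m = ∈-vars-⟨⟩⁺ t m (here refl)

  ∈-vars-ren⁻ : ∀ {P t y} → y ∈ vars (t ⟨ ren P ⟩) → π⁻ P y ∈ vars t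
  ∈-vars-ren⁻ {P} {t} m with ∈-vars-⟨⟩⁻ t m
  ... | x , a , here refl = subst (_∈ vars t) (sym (inv₁ P x)) a

  Equations : Set
  Equations = List (Term × Term)

  Unifies : Subst → Equations → Set
  Unifies θ [] = ⊤
  Unifies θ ((a , b) ∷ E) = a ⟨ θ ⟩ ≡ b ⟨ θ ⟩ × Unifies θ E

  WellSorted : Equations → Set
  WellSorted [] = ⊤
  WellSorted ((a , b) ∷ E) = (Σ[ ι ∈ Sort ] (a ∶ ι × b ∶ ι)) × WellSorted E

  varsᴱ : Equations → List Var
  varsᴱ [] = []
  varsᴱ ((a , b) ∷ E) = vars a ++ vars b ++ varsᴱ E

  mutual
    size : Term → ℕ
    size (var x) = 1
    size (app f ts) = suc (sizes ts)

    sizes : List Term → ℕ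
    sizes [] = 0
    sizes (t ∷ ts) = size t + sizes ts

  sizeᴱ : Equations → ℕ
  sizeᴱ [] = 0
  sizeᴱ ((a , b) ∷ E) = size a + size b + sizeᴱ E

  infixl 30 _⟨_⟩ᴱ
  _⟨_⟩ᴱ : Equations → Subst → Equations
  [] ⟨ σ ⟩ᴱ = []
  ((a , b) ∷ E) ⟨ σ ⟩ᴱ = (a ⟨ σ ⟩ , b ⟨ σ ⟩) ∷ E ⟨ σ ⟩ᴱ

  zipᴱ : List Term → List Term → Equations
  zipᴱ (s ∷ ss) (t ∷ ts) = (s , t) ∷ zipᴱ ss ts
  zipᴱ _ _ = []

  Unifies-⟨⟩⁺ : ∀ E {σ θ} → Unifies (σ ⨾ θ) E → Unifies θ (E ⟨ σ ⟩ᴱ)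
  Unifies-⟨⟩⁺ [] u = tt
  Unifies-⟨⟩⁺ ((a , b) ∷ E) (e , u) = trans (⟨⟩-⨾ a) (trans e (sym (⟨⟩-⨾ b))) , Unifies-⟨⟩⁺ E u

  Unifies-⟨⟩⁻ : ∀ E {σ θ} → Unifies θ (E ⟨ σ ⟩ᴱ) → Unifies (σ ⨾ θ) E
  Unifies-⟨⟩⁻ [] u = tt
  Unifies-⟨⟩⁻ ((a , b) ∷ E) (e , u) = trans (sym (⟨⟩-⨾ a)) (trans e (⟨⟩-⨾ b)) , Unifies-⟨⟩⁻ E u

  Unifies-cong : ∀ E {θ θ'} → (∀ x → θ x ≡ θ' x) → Unifies θ E → Unifies θ' E
  Unifies-cong [] h u = tt
  Unifies-cong ((a , b) ∷ E) h (e , u) = trans (sym (⟨⟩-cong a h)) (trans e (⟨⟩-cong b h)) , Unifies-cong E h u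

  Unifies-++⁺ : ∀ E₁ {E₂ θ} → Unifies θ E₁ → Unifies θ E₂ → Unifies θ (E₁ ++ E₂)
  Unifies-++⁺ [] u v = v
  Unifies-++⁺ (e ∷ E₁) (x , u) v = x , Unifies-++⁺ E₁ u v

  Unifies-++⁻ : ∀ E₁ {E₂ θ} → Unifies θ (E₁ ++ E₂) → Unifies θ E₁ × Unifies θ E₂
  Unifies-++⁻ [] v = tt , v
  Unifies-++⁻ (e ∷ E₁) (x , u) = (x , proj₁ (Unifies-++⁻ E₁ u)) , proj₂ (Unifies-++⁻ E₁ u)

  Unifies-zip⁺ : ∀ {ss ts ιs θ} → ss ∶* ιs → ts ∶* ιs → ss ⟨ θ ⟩* ≡ ts ⟨ θ ⟩* → Unifies θ (zipᴱ ss ts)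
  Unifies-zip⁺ [] [] e = tt
  Unifies-zip⁺ (_ ∷ ds) (_ ∷ ds') e = proj₁ (∷-injective e) , Unifies-zip⁺ ds ds' (proj₂ (∷-injective e))

  Unifies-zip⁻ : ∀ {ss ts ιs θ} → ss ∶* ιs → ts ∶* ιs → Unifies θ (zipᴱ ss ts) → ss ⟨ θ ⟩* ≡ ts ⟨ θ ⟩*
  Unifies-zip⁻ [] [] u = refl
  Unifies-zip⁻ (_ ∷ ds) (_ ∷ ds') (e , u) = cong₂ _∷_ e (Unifies-zip⁻ ds ds' u)

  WellSorted-++ : ∀ E₁ {E₂} → WellSorted E₁ → WellSorted E₂ → WellSorted (E₁ ++ E₂)
  WellSorted-++ [] _ s = s
  WellSorted-++ (e ∷ E₁) (x , u) s = x , WellSorted-++ E₁ u s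

  WellSorted-⟨⟩ : ∀ E {σ} → WS σ → WellSorted E → WellSorted (E ⟨ σ ⟩ᴱ)
  WellSorted-⟨⟩ [] ws _ = tt
  WellSorted-⟨⟩ ((a , b) ∷ E) ws ((ι , da , db) , s) = (ι , ∶-⟨⟩ ws da , ∶-⟨⟩ ws db) , WellSorted-⟨⟩ E ws s

  WellSorted-zip : ∀ {ss ts ιs} → ss ∶* ιs → ts ∶* ιs → WellSorted (zipᴱ ss ts)
  WellSorted-zip [] [] = tt
  WellSorted-zip (d ∷ ds) (d' ∷ ds') = (_ , d , d') , WellSorted-zip ds ds'

  ∈-varsᴱ-++⁻ : ∀ E₁ {E₂ z} → z ∈ varsᴱ (E₁ ++ E₂) → z ∈ varsᴱ E₁ ⊎ z ∈ varsᴱ E₂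
  ∈-varsᴱ-++⁻ [] m = inj₂ m
  ∈-varsᴱ-++⁻ ((a , b) ∷ E₁) m with ∈-++⁻ (vars a) m
  ... | inj₁ ma = inj₁ (∈-++⁺ˡ ma)
  ... | inj₂ m' with ∈-++⁻ (vars b) m'
  ...   | inj₁ mb = inj₁ (∈-++⁺ʳ (vars a) (∈-++⁺ˡ mb))
  ...   | inj₂ m'' with ∈-varsᴱ-++⁻ E₁ m''
  ...     | inj₁ m₁ = inj₁ (∈-++⁺ʳ (vars a) (∈-++⁺ʳ (vars b) m₁))
  ...     | inj₂ m₂ = inj₂ m₂

  ∈-varsᴱ-⟨⟩⁻ : ∀ E {σ z} → z ∈ varsᴱ (E ⟨ σ ⟩ᴱ) → Σ[ x ∈ Var ] (x ∈ varsᴱ E × z ∈ vars (σ x))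
  ∈-varsᴱ-⟨⟩⁻ ((a , b) ∷ E) {σ} m with ∈-++⁻ (vars (a ⟨ σ ⟩)) m
  ... | inj₁ ma with ∈-vars-⟨⟩⁻ a ma
  ...   | x , p , q = x , ∈-++⁺ˡ p , q
  ∈-varsᴱ-⟨⟩⁻ ((a , b) ∷ E) {σ} m | inj₂ m' with ∈-++⁻ (vars (b ⟨ σ ⟩)) m'
  ...   | inj₁ mb with ∈-vars-⟨⟩⁻ b mb
  ...     | x , p , q = x , ∈-++⁺ʳ (vars a) (∈-++⁺ˡ p) , q
  ∈-varsᴱ-⟨⟩⁻ ((a , b) ∷ E) {σ} m | inj₂ m' | inj₂ m'' with ∈-varsᴱ-⟨⟩⁻ E m''
  ...     | x , p , q = x , ∈-++⁺ʳ (vars a) (∈-++⁺ʳ (vars b) p) , q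

  ∈-varsᴱ-zip⁻ : ∀ ss ts {z} → z ∈ varsᴱ (zipᴱ ss ts) → z ∈ vars* ss ⊎ z ∈ vars* ts
  ∈-varsᴱ-zip⁻ (s ∷ ss) (t ∷ ts) m with ∈-++⁻ (vars s) m
  ... | inj₁ ms = inj₁ (∈-++⁺ˡ ms)
  ... | inj₂ m' with ∈-++⁻ (vars t) m'
  ...   | inj₁ mt = inj₂ (∈-++⁺ˡ mt)
  ...   | inj₂ m'' with ∈-varsᴱ-zip⁻ ss ts m''
  ...     | inj₁ k = inj₁ (∈-++⁺ʳ (vars s) k)
  ...     | inj₂ k = inj₂ (∈-++⁺ʳ (vars t) k)

  sizeᴱ-++ : ∀ E₁ {E₂} → sizeᴱ (E₁ ++ E₂) ≡ sizeᴱ E₁ + sizeᴱ E₂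
  sizeᴱ-++ [] = refl
  sizeᴱ-++ ((a , b) ∷ E₁) {E₂} rewrite sizeᴱ-++ E₁ {E₂} = sym (+-assoc (size a + size b) (sizeᴱ E₁) (sizeᴱ E₂))

  sizeᴱ-zip : ∀ {ss ts ιs} → ss ∶* ιs → ts ∶* ιs → sizeᴱ (zipᴱ ss ts) ≡ sizes ss + sizes ts
  sizeᴱ-zip [] [] = refl
  sizeᴱ-zip {s ∷ ss} {t ∷ ts} (_ ∷ ds) (_ ∷ ds') rewrite sizeᴱ-zip ds ds' =
    sym (+-interchange (size s) (sizes ss) (size t) (sizes ts))
    where
    +-interchange : ∀ a c b d → (a + c) + (b + d) ≡ (a + b) + (c + d)
    +-interchange a c b d rewrite +-assoc a c (b + d) | +-assoc a b (c + d)
                                | sym (+-assoc c b d) | +-comm c b | +-assoc b c d = refl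

  mutual
    size-⟨⟩-var : ∀ t {θ x} → x ∈ vars t → size (θ x) ≤ size (t ⟨ θ ⟩)
    size-⟨⟩-var (var y) (here refl) = ≤-refl
    size-⟨⟩-var (app f ts) m = m≤n⇒m≤1+n (size-⟨⟩*-var ts m)

    size-⟨⟩*-var : ∀ ts {θ x} → x ∈ vars* ts → size (θ x) ≤ sizes (ts ⟨ θ ⟩*)
    size-⟨⟩*-var (t ∷ ts) {θ} m with ∈-++⁻ (vars t) m
    ... | inj₁ m' = ≤-trans (size-⟨⟩-var t m') (m≤m+n (size (t ⟨ θ ⟩)) _)
    ... | inj₂ m' = ≤-trans (size-⟨⟩*-var ts m') (m≤n+m _ (size (t ⟨ θ ⟩)))

  occurs-check : ∀ {θ x g ts} → x ∈ vars* ts → θ x ≢ app g (ts ⟨ θ ⟩*)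
  occurs-check {θ} {ts = ts} m e = <-irrefl refl (subst (λ z → size z ≤ sizes (ts ⟨ θ ⟩*)) e (size-⟨⟩*-var ts m))

  [_↦_] : Var → Term → Subst
  [ x ↦ t ] z with z ≟V x
  ... | yes _ = t
  ... | no _ = var z

  ↦-here : ∀ x t → [ x ↦ t ] x ≡ t
  ↦-here x t with x ≟V x
  ... | yes _ = refl
  ... | no x≢x = ⊥-elim (x≢x refl)

  ↦-there : ∀ x t z → z ≢ x → [ x ↦ t ] z ≡ var z
  ↦-there x t z z≢x with z ≟V x
  ... | yes e = ⊥-elim (z≢x e)
  ... | no _ = refl

  ↦-WS : ∀ x t → t ∶ vsort x → WS [ x ↦ t ]
  ↦-WS x t d z with z ≟V x
  ... | yes refl = d
  ... | no _ = var∶ z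

  ↦-⨾ : ∀ {x t θ} → θ x ≡ t ⟨ θ ⟩ → ∀ z → ([ x ↦ t ] ⨾ θ) z ≡ θ z
  ↦-⨾ {x} e z with z ≟V x
  ... | yes refl = sym e
  ... | no _ = refl

  ↦-unused : ∀ x t s → x ∉ vars s → s ⟨ [ x ↦ t ] ⟩ ≡ s
  ↦-unused x t s x∉s =
    trans (⟨⟩-cong-on s (λ z m → ↦-there x t z (λ e → x∉s (subst (_∈ vars s) e m)))) (⟨⟩-identity s)

  MostGeneral : Equations → Subst → Set
  MostGeneral E σ = ∀ θ → Unifies θ E → ∀ x → θ x ≡ σ x ⟨ θ ⟩

  IsMGU : Equations → Subst → Set
  IsMGU E σ = WS σ × Unifies σ E × MostGeneral E σ

  IsMGU-sym : ∀ {a b E σ} → IsMGU ((a , b) ∷ E) σ → IsMGU ((b , a) ∷ E) σ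
  IsMGU-sym (wσ , (e , u) , mg) = wσ , (sym e , u) , λ θ u' → mg θ (sym (proj₁ u') , proj₂ u')

  private
    nonempty-length : ∀ {x} {D : List Var} → x ∈ D → length D ≤ 0 → ⊥
    nonempty-length (here _) ()
    nonempty-length (there _) ()

    decompose-size : ∀ a b c m → suc a + suc b + c ≤ suc m → a + b + c ≤ m
    decompose-size a b c m h rewrite +-suc a b = <⇒≤ (≤-pred h)

    var-sort : ∀ {x t} → Σ[ ι ∈ Sort ] (var x ∶ ι × t ∶ ι) → t ∶ vsort x
    var-sort (ι , var∶ _ , d) = d

    swap-sort : ∀ {a b} → Σ[ ι ∈ Sort ] (a ∶ ι × b ∶ ι) → Σ[ ι ∈ Sort ] (b ∶ ι × a ∶ ι)
    swap-sort (ι , d , d') = ι , d' , d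

  -- Robinson's algorithm on a solvable problem E, by lexicographic induction on
  -- (length D, sizeᴱ E) for a list D covering the variables of E.  The given
  -- unifier θ only serves to refute the failure cases (clash, occurs check).
  mutual
    unify : ∀ k m D E → length D ≤ k → sizeᴱ E ≤ m → varsᴱ E ⊆ D → WellSorted E →
            ∀ θ → WS θ → Unifies θ E → Σ[ σ ∈ Subst ] IsMGU E σ
    unify k m D [] _ _ _ _ _ _ _ = var , WS-var , tt , λ θ _ x → refl
    unify k zero D ((var x , var y) ∷ E) _ () _ _ _ _ _
    unify k (suc m) D ((var x , var y) ∷ E) lk sm E⊆D (so , soE) θ wθ (u , uE) with x ≟V y
    ... | yes refl =
      let σ , wσ , uσ , mg = unify k m D E lk (<⇒≤ (≤-pred sm)) (λ mz → E⊆D (there (there mz))) soE θ wθ uE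
      in σ , wσ , (refl , uσ) , λ θ' u' → mg θ' (proj₂ u')
    ... | no x≢y = eliminate k D x (var y) E lk (E⊆D (here refl)) (λ { (here refl) → E⊆D (there (here refl)) })
                     (λ mz → E⊆D (there (there mz))) (λ { (here e) → x≢y e }) (var-sort so) soE θ wθ u uE
    unify k m D ((var x , app g ts) ∷ E) lk sm E⊆D (so , soE) θ wθ (u , uE) with x ∈? vars* ts
    ... | yes occ = ⊥-elim (occurs-check occ u)
    ... | no x∉ts = eliminate k D x (app g ts) E lk (E⊆D (here refl)) (λ mz → E⊆D (there (∈-++⁺ˡ mz)))
                      (λ mz → E⊆D (there (∈-++⁺ʳ (vars* ts) mz))) x∉ts (var-sort so) soE θ wθ u uE
    unify k m D ((app f ss , var y) ∷ E) lk sm E⊆D (so , soE) θ wθ (u , uE) with y ∈? vars* ss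
    ... | yes occ = ⊥-elim (occurs-check occ (sym u))
    ... | no y∉ss = map₂ (IsMGU-sym {var y} {app f ss}) (eliminate k D y (app f ss) E lk (E⊆D (∈-++⁺ʳ (vars* ss) (here refl)))
                      (λ mz → E⊆D (∈-++⁺ˡ mz)) (λ mz → E⊆D (∈-++⁺ʳ (vars* ss) (there mz))) y∉ss
                      (var-sort (swap-sort so)) soE θ wθ (sym u) uE)
    unify k zero D ((app f ss , app g ts) ∷ E) _ () _ _ _ _ _
    unify k (suc m) D ((app f ss , app g ts) ∷ E) lk sm E⊆D ((ι , app∶ ds , dg) , soE) θ wθ (u , uE)
      with app-injective u
    ... | refl , u* with dg
    ...   | app∶ dt =
      let σ , wσ , uσ , mg = unify k m D (zipᴱ ss ts ++ E) lk size′ ⊆D′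
                               (WellSorted-++ (zipᴱ ss ts) (WellSorted-zip ds dt) soE) θ wθ
                               (Unifies-++⁺ (zipᴱ ss ts) (Unifies-zip⁺ ds dt u*) uE)
          uz , uE′ = Unifies-++⁻ (zipᴱ ss ts) uσ
      in σ , wσ , (cong (app f) (Unifies-zip⁻ ds dt uz) , uE′) ,
         λ θ' u' → mg θ' (Unifies-++⁺ (zipᴱ ss ts) (Unifies-zip⁺ ds dt (proj₂ (app-injective (proj₁ u')))) (proj₂ u'))
      where
      size′ : sizeᴱ (zipᴱ ss ts ++ E) ≤ m
      size′ rewrite sizeᴱ-++ (zipᴱ ss ts) {E} | sizeᴱ-zip ds dt = decompose-size (sizes ss) (sizes ts) (sizeᴱ E) m sm
      ⊆D′ : varsᴱ (zipᴱ ss ts ++ E) ⊆ D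
      ⊆D′ mz with ∈-varsᴱ-++⁻ (zipᴱ ss ts) mz
      ... | inj₂ k′ = E⊆D (∈-++⁺ʳ (vars* ss) (∈-++⁺ʳ (vars* ts) k′))
      ... | inj₁ k′ with ∈-varsᴱ-zip⁻ ss ts k′
      ...   | inj₁ k″ = E⊆D (∈-++⁺ˡ k″)
      ...   | inj₂ k″ = E⊆D (∈-++⁺ʳ (vars* ss) (∈-++⁺ˡ k″))

    -- Solve E [ x ↦ t ] over the variables D without x, then compose.
    eliminate : ∀ k D x t E → length D ≤ k → x ∈ D → vars t ⊆ D → varsᴱ E ⊆ D → x ∉ vars t →
                t ∶ vsort x → WellSorted E → ∀ θ → WS θ → θ x ≡ t ⟨ θ ⟩ → Unifies θ E →
                Σ[ σ ∈ Subst ] IsMGU ((var x , t) ∷ E) σ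
    eliminate zero D x _ _ lk x∈D _ _ _ _ _ _ _ _ _ = ⊥-elim (nonempty-length x∈D lk)
    eliminate (suc k) D x t E lk x∈D t⊆D E⊆D x∉t t∶x so θ wθ θx uE =
      β ⨾ σ , WS-⨾ wβ wσ , (σ-solves-x , Unifies-⟨⟩⁻ E uσ) , most-general
      where
      β = [ x ↦ t ]
      wβ = ↦-WS x t t∶x
      x? = λ z → ¬? (z ≟V x)
      D′ = filter x? D
      lk′ : length D′ ≤ k
      lk′ = ≤-pred (≤-trans (filter-notAll x? D (Any.map (λ { refl x≢x → x≢x refl }) x∈D)) lk)
      ⊆D′ : varsᴱ (E ⟨ β ⟩ᴱ) ⊆ D′
      ⊆D′ {z} mz with ∈-varsᴱ-⟨⟩⁻ E mz
      ... | w , mw , z∈βw = by-cases (w ≟V x)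
        where
        by-cases : Dec (w ≡ x) → z ∈ D′
        by-cases (yes refl) = ∈-filter⁺ x? (t⊆D (subst (λ q → z ∈ vars q) (↦-here x t) z∈βw))
                                (λ { refl → x∉t (subst (λ q → x ∈ vars q) (↦-here x t) z∈βw) })
        by-cases (no w≢x) with subst (λ q → z ∈ vars q) (↦-there x t w w≢x) z∈βw
        ... | here refl = ∈-filter⁺ x? (E⊆D mw) w≢x
      β-unifier : ∀ {θ'} → θ' x ≡ t ⟨ θ' ⟩ → Unifies θ' E → Unifies θ' (E ⟨ β ⟩ᴱ)
      β-unifier e u = Unifies-⟨⟩⁺ E (Unifies-cong E (λ z → sym (↦-⨾ e z)) u)
      rec = unify k (sizeᴱ (E ⟨ β ⟩ᴱ)) D′ (E ⟨ β ⟩ᴱ) lk′ ≤-refl ⊆D′ (WellSorted-⟨⟩ E wβ so)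
                  θ wθ (β-unifier θx uE)
      σ = proj₁ rec
      wσ = proj₁ (proj₂ rec)
      uσ = proj₁ (proj₂ (proj₂ rec))
      σ-solves-x : β x ⟨ σ ⟩ ≡ t ⟨ β ⨾ σ ⟩
      σ-solves-x = trans (cong (_⟨ σ ⟩) (trans (↦-here x t) (sym (↦-unused x t t x∉t)))) (⟨⟩-⨾ t)
      most-general : MostGeneral ((var x , t) ∷ E) (β ⨾ σ)
      most-general θ' (e , u) z =
        trans (sym (↦-⨾ e z))
          (trans (⟨⟩-cong (β z) (proj₂ (proj₂ (proj₂ rec)) θ' (β-unifier e u))) (sym (⟨⟩-⨾ (β z))))

  MGU-exists : ∀ a b {ι} → a ∶ ι → b ∶ ι → ∀ θ → WS θ → a ⟨ θ ⟩ ≡ b ⟨ θ ⟩ →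
               Σ[ σ ∈ Subst ] (MGU σ a b × MostGeneral ((a , b) ∷ []) σ)
  MGU-exists a b {ι} da db θ wθ e =
    let σ , wσ , (eσ , _) , mg = unify (length (varsᴱ E)) (sizeᴱ E) (varsᴱ E) E ≤-refl ≤-refl (λ m → m)
                                       ((ι , da , db) , tt) θ wθ (e , tt)
    in σ , (wσ , eσ , λ θ' wθ' e' → θ' , wθ' , mg θ' (e' , tt)) , mg
    where E = (a , b) ∷ []

  ValOrVar : Term → Set
  ValOrVar t = IsVal t ⊎ Σ[ y ∈ Var ] (t ≡ var y)

  ValOrVar-ren : ∀ {t} P → ValOrVar t → ValOrVar (t ⟨ ren P ⟩)
  ValOrVar-ren P (inj₁ v) = inj₁ (IsVal-stable v)
  ValOrVar-ren P (inj₂ (y , refl)) = inj₂ (Renaming.π P y , refl)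

  ValOrVar-instance : ∀ t {θ v} → t ⟨ θ ⟩ ≡ ⌜ v ⌝ → Val v → ValOrVar t
  ValOrVar-instance (var y) e v-val = inj₂ (y , refl)
  ValOrVar-instance (app g []) e v-val with app-injective e
  ... | refl , _ = inj₁ (val v-val)
  ValOrVar-instance (app g (_ ∷ _)) e v-val with app-injective e
  ... | _ , ()

  select : {P : Var → Set} → (∀ x → Dec (P x)) → Subst → Subst → Subst
  select P? σ θ x with P? x
  ... | yes _ = σ x
  ... | no _ = θ x

  select-yes : ∀ {P : Var → Set} (P? : ∀ x → Dec (P x)) {σ θ x} → P x → select P? σ θ x ≡ σ x
  select-yes P? {x = x} p with P? x
  ... | yes _ = refl
  ... | no ¬p = ⊥-elim (¬p p)

  select-no : ∀ {P : Var → Set} (P? : ∀ x → Dec (P x)) {σ θ x} → ¬ P x → select P? σ θ x ≡ θ x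
  select-no P? {x = x} ¬p with P? x
  ... | yes p = ⊥-elim (¬p p)
  ... | no _ = refl

  select-preserves : ∀ {P : Var → Set} (P? : ∀ x → Dec (P x)) {σ θ} (Q : Var → Term → Set) →
                     (∀ x → Q x (σ x)) → (∀ x → Q x (θ x)) → ∀ x → Q x (select P? σ θ x)
  select-preserves P? Q qσ qθ x with P? x
  ... | yes _ = qσ x
  ... | no _ = qθ x

  record RuleShape (ρ : Rule) : Set where
    field
      sort : Sort
      lhs∶ : lhs ρ ∶ sort
      root : Fun
      args : List Term
      lhs≡ : lhs ρ ≡ app root args
      root-nonval : ¬ Val root
      con∶bool : con ρ ∶ bool

  var*-∶ : ∀ {xs ιs} → Pointwise (λ x ι → vsort x ≡ ι) xs ιs → map var xs ∶* ιs
  var*-∶ [] = []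
  var*-∶ (_∷_ {x = x} refl p) = var∶ x ∷ var*-∶ p

  Calc-shape : ∀ {ρ} → Calc ρ → RuleShape ρ
  Calc-shape (calc f xs y th f-nonval _ _ xs-sorts y-sort) = record
    { sort = res f ; lhs∶ = app∶ (var*-∶ xs-sorts)
    ; root = f ; args = map var xs ; lhs≡ = refl ; root-nonval = f-nonval
    ; con∶bool = subst (eqₜ (res f) (var y) (app f (map var xs)) ∶_) eq-res
                   (app∶ (subst ((var y ∷ app f (map var xs) ∷ []) ∶*_) (sym eq-ar)
                   (subst (var y ∶_) y-sort (var∶ y) ∷ app∶ (var*-∶ xs-sorts) ∷ [])))
    }
    where
    eq-ar = proj₁ (proj₂ (proj₂ (eq-th (res f) f th (inj₁ refl))))
    eq-res = proj₂ (proj₂ (proj₂ (eq-th (res f) f th (inj₁ refl))))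

  LV? : ∀ ρ x → Dec (LV ρ x)
  LV? ρ x with x ∈? vars (con ρ)
  ... | yes m = yes (inj₁ m)
  ... | no ∉con with x ∈? vars (rhs ρ)
  ...   | no ∉rhs = no λ { (inj₁ m) → ∉con m ; (inj₂ (m , _)) → ∉rhs m }
  ...   | yes m with x ∈? vars (lhs ρ)
  ...     | yes m' = no λ { (inj₁ m) → ∉con m ; (inj₂ (_ , ∉lhs)) → ∉lhs m' }
  ...     | no ∉lhs = yes (inj₂ (m , ∉lhs))

  ∈-ruleVars-lhs : ∀ ρ {x} → x ∈ vars (lhs ρ) → x ∈ ruleVars ρ
  ∈-ruleVars-lhs ρ m = ∈-++⁺ˡ m

  ∈-ruleVars-rhs : ∀ ρ {x} → x ∈ vars (rhs ρ) → x ∈ ruleVars ρ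
  ∈-ruleVars-rhs ρ m = ∈-++⁺ʳ (vars (lhs ρ)) (∈-++⁺ˡ m)

  ∈-ruleVars-con : ∀ ρ {x} → x ∈ vars (con ρ) → x ∈ ruleVars ρ
  ∈-ruleVars-con ρ m = ∈-++⁺ʳ (vars (lhs ρ)) (∈-++⁺ʳ (vars (rhs ρ)) m)

  LV⊆ruleVars : ∀ ρ {x} → LV ρ x → x ∈ ruleVars ρ
  LV⊆ruleVars ρ (inj₁ m) = ∈-ruleVars-con ρ m
  LV⊆ruleVars ρ (inj₂ (m , _)) = ∈-ruleVars-rhs ρ m

  rename : Rule → Renaming → Rule
  rename ρ P = lhs ρ ⟨ ren P ⟩ ⟶ rhs ρ ⟨ ren P ⟩ [ con ρ ⟨ ren P ⟩ ]

  ∈-ruleVars-rename⁻ : ∀ ρ P {x} → x ∈ ruleVars (rename ρ P) → π⁻ P x ∈ ruleVars ρ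
  ∈-ruleVars-rename⁻ ρ P m with ∈-++⁻ (vars (lhs ρ ⟨ ren P ⟩)) m
  ... | inj₁ m' = ∈-ruleVars-lhs ρ (∈-vars-ren⁻ {P} {lhs ρ} m')
  ... | inj₂ m' with ∈-++⁻ (vars (rhs ρ ⟨ ren P ⟩)) m'
  ...   | inj₁ m'' = ∈-ruleVars-rhs ρ (∈-vars-ren⁻ {P} {rhs ρ} m'')
  ...   | inj₂ m'' = ∈-ruleVars-con ρ (∈-vars-ren⁻ {P} {con ρ} m'')

  record VariantBy (P : Renaming) (ρ ρ' : Rule) : Set where
    constructor variant-by
    field
      lhs≡ : lhs ρ' ≡ lhs ρ ⟨ ren P ⟩
      rhs≡ : rhs ρ' ≡ rhs ρ ⟨ ren P ⟩
      con≡ : con ρ' ≡ con ρ ⟨ ren P ⟩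

  LV-variant⁺ : ∀ {ρ ρ' P x} → VariantBy P ρ ρ' → LV ρ x → LV ρ' (π P x)
  LV-variant⁺ {ρ} {P = P} (variant-by refl refl refl) (inj₁ m) = inj₁ (∈-vars-ren⁺ {P} {con ρ} m)
  LV-variant⁺ {ρ} {P = P} {x} (variant-by refl refl refl) (inj₂ (m , ∉lhs)) =
    inj₂ (∈-vars-ren⁺ {P} {rhs ρ} m ,
          λ m' → ∉lhs (subst (_∈ vars (lhs ρ)) (inv₁ P x) (∈-vars-ren⁻ {P} {lhs ρ} m')))

  LV-variant⁻ : ∀ {ρ ρ' P y} → VariantBy P ρ ρ' → LV ρ' y → LV ρ (π⁻ P y)
  LV-variant⁻ {ρ} {P = P} (variant-by refl refl refl) (inj₁ m) = inj₁ (∈-vars-ren⁻ {P} {con ρ} m)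
  LV-variant⁻ {ρ} {P = P} {y} (variant-by refl refl refl) (inj₂ (m , ∉lhs)) =
    inj₂ (∈-vars-ren⁻ {P} {rhs ρ} m ,
          λ m' → ∉lhs (subst (_∈ vars (lhs ρ ⟨ ren P ⟩)) (inv₂ P y) (∈-vars-ren⁺ {P} {lhs ρ} m')))

  ⋀-≈-vars : ∀ xs {z} → z ∈ vars (⋀ (map (λ x → eqₜ (vsort x) (var x) (var x)) xs)) → z ∈ xs
  ⋀-≈-vars (x ∷ xs) (here refl) = here refl
  ⋀-≈-vars (x ∷ xs) (there (here refl)) = here refl
  ⋀-≈-vars (x ∷ xs) (there (there m)) with ∈-++⁻ (vars (⋀ (map (λ x → eqₜ (vsort x) (var x) (var x)) xs))) m
  ... | inj₁ m' = there (⋀-≈-vars xs m')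

  EV⊆LV : ∀ ρ {z} → z ∈ EV ρ → LV ρ z
  EV⊆LV ρ m with ∈-filter⁻ (λ x → ¬? (x ∈? (vars (lhs ρ) ++ vars (con ρ)))) {xs = vars (rhs ρ)} m
  ... | mr , n = inj₂ (mr , λ ml → n (∈-++⁺ˡ ml))

  EC-vars⊆LV : ∀ ρ {z} → z ∈ vars (EC ρ) → LV ρ z
  EC-vars⊆LV ρ m = EV⊆LV ρ (⋀-≈-vars (EV ρ) m)

  Eval-⋀-≈ : ∀ xs {θ} → (∀ x → x ∈ xs → IsVal (θ x)) → WS θ →
             Eval ((⋀ (map (λ x → eqₜ (vsort x) (var x) (var x)) xs)) ⟨ θ ⟩) top
  Eval-⋀-≈ [] h w = Eval-⌜⌝ top-val
  Eval-⋀-≈ (x ∷ xs) h w = Eval-∧-intro (Eval-eq-refl (h x (here refl)) (w x)) (Eval-⋀-≈ xs (λ z m → h z (there m)) w)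

  Eval-EC : ∀ ρ {θ} → (∀ x → LV ρ x → IsVal (θ x)) → WS θ → Eval (EC ρ ⟨ θ ⟩) top
  Eval-EC ρ h w = Eval-⋀-≈ (EV ρ) (λ x m → h x (EV⊆LV ρ m)) w

  ∈-vars-var*⁻ : ∀ {z} xs → z ∈ vars* (map var xs) → z ∈ xs
  ∈-vars-var*⁻ (x ∷ xs) (here refl) = here refl
  ∈-vars-var*⁻ (x ∷ xs) (there m) = there (∈-vars-var*⁻ xs m)

  ∈-vars-var*⁺ : ∀ {z} xs → z ∈ xs → z ∈ vars* (map var xs)
  ∈-vars-var*⁺ (x ∷ xs) (here refl) = here refl
  ∈-vars-var*⁺ (x ∷ xs) (there m) = there (∈-vars-var*⁺ xs m)

  zipSubst : List Var → List Fun → Subst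
  zipSubst (x ∷ xs) (v ∷ vs) z with z ≟V x
  ... | yes _ = ⌜ v ⌝
  ... | no _ = zipSubst xs vs z
  zipSubst _ _ z = var z

  zipSubst-here : ∀ x xs v vs → zipSubst (x ∷ xs) (v ∷ vs) x ≡ ⌜ v ⌝
  zipSubst-here x xs v vs with x ≟V x
  ... | yes _ = refl
  ... | no x≢x = ⊥-elim (x≢x refl)

  zipSubst-there : ∀ x xs v vs z → z ≢ x → zipSubst (x ∷ xs) (v ∷ vs) z ≡ zipSubst xs vs z
  zipSubst-there x xs v vs z z≢x with z ≟V x
  ... | yes e = ⊥-elim (z≢x e)
  ... | no _ = refl

  zipSubst-outside : ∀ xs vs z → z ∉ xs → zipSubst xs vs z ≡ var z
  zipSubst-outside [] vs z _ = refl
  zipSubst-outside (x ∷ xs) [] z _ = refl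
  zipSubst-outside (x ∷ xs) (v ∷ vs) z z∉ =
    trans (zipSubst-there x xs v vs z (λ e → z∉ (here e))) (zipSubst-outside xs vs z (λ m → z∉ (there m)))

  zipSubst-var* : ∀ {xs vs ιs} → Unique xs → Pointwise (λ x ι → vsort x ≡ ι) xs ιs → Pointwise ValOfSort vs ιs →
                  (map var xs) ⟨ zipSubst xs vs ⟩* ≡ map ⌜_⌝ vs
  zipSubst-var* [] [] [] = refl
  zipSubst-var* {x ∷ xs} {v ∷ vs} (x∉xs ∷ u) (_ ∷ p) (_ ∷ q) =
    cong₂ _∷_ (zipSubst-here x xs v vs)
      (trans (⟨⟩*-cong-on (map var xs) (λ z m → zipSubst-there x xs v vs z
                 (λ e → All.lookup x∉xs (∈-vars-var*⁻ xs m) (sym e))))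
             (zipSubst-var* u p q))

  zipSubst-value : ∀ {xs vs ιs z} → Pointwise (λ x ι → vsort x ≡ ι) xs ιs → Pointwise ValOfSort vs ιs → z ∈ xs →
                   IsVal (zipSubst xs vs z) × zipSubst xs vs z ∶ vsort z
  zipSubst-value {x ∷ xs} {v ∷ vs} {z = z} (x-sort ∷ p) ((v-val , v-sort) ∷ q) m with z ≟V x
  ... | yes refl = val v-val , subst (⌜ v ⌝ ∶_) (trans v-sort (sym x-sort)) (⌜⌝-∶ v-val)
  ... | no z≢x with m
  ...   | here e = ⊥-elim (z≢x e)
  ...   | there m' = zipSubst-value p q m'

  fresh-vars : (ιs : List Sort) → Σ[ xs ∈ List Var ] (Unique xs × Pointwise (λ x ι → vsort x ≡ ι) xs ιs)
  fresh-vars [] = [] , [] , []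
  fresh-vars (ι ∷ ιs) with fresh-vars ιs
  ... | xs , u , p with fresh ι xs
  ...   | x , x-sort , x∉xs = x ∷ xs , All.tabulate (λ m e → x∉xs (subst (_∈ xs) (sym e) m)) ∷ u , x-sort ∷ p

  module _ {T : Term → Term → Set} where
    open TRS T

    mutual
      MS-refl : ∀ t → MS t t
      MS-refl (var x) = mvar x
      MS-refl (app f ts) = mapp f (MS*-refl ts)

      MS*-refl : ∀ ts → MS* ts ts
      MS*-refl [] = []
      MS*-refl (t ∷ ts) = MS-refl t ∷ MS*-refl ts

  module _ (R : Rule → Set) (isL : IsLCTRS R) where
    open LCTRS R
    module T = TRS Rbar

    Rrc-shape : ∀ {ρ} → Rrc ρ → RuleShape ρ
    Rrc-shape (inj₂ c) = Calc-shape c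
    Rrc-shape (inj₁ r) with isL _ r
    ... | (ι , lhs∶ , _) , (f , ts , lhs≡ , _ , f∉Th) , (_ , con∶) =
      record { sort = ι ; lhs∶ = lhs∶ ; root = f ; args = ts ; lhs≡ = lhs≡
             ; root-nonval = λ v → f∉Th (val⊆th f v) ; con∶bool = con∶ }

    record RbarInstance (ℓ r : Term) : Set where
      field
        ρ : Rule
        τ : Subst
        rrc : Rrc ρ
        LV-value : ∀ x → LV ρ x → IsVal (τ x) × τ x ∶ vsort x
        non-LV-id : ∀ x → ¬ LV ρ x → τ x ≡ var x
        valid : Valid (con ρ ⟨ τ ⟩)
        lhs≡ : ℓ ≡ lhs ρ ⟨ τ ⟩
        rhs≡ : r ≡ rhs ρ ⟨ τ ⟩

      τ-WS : WS τ
      τ-WS x with LV? ρ x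
      ... | yes l = proj₂ (LV-value x l)
      ... | no n = subst (_∶ vsort x) (sym (non-LV-id x n)) (var∶ x)

      τ-value-or-var : ∀ x → ValOrVar (τ x)
      τ-value-or-var x with LV? ρ x
      ... | yes l = inj₁ (proj₁ (LV-value x l))
      ... | no n = inj₂ (x , non-LV-id x n)

      con-closed : Closed (con ρ ⟨ τ ⟩)
      con-closed = ValuedOn-closed (con ρ) (λ x m → proj₁ (LV-value x (inj₁ m)))

    -- f(v₁,…,vₙ) → ⟦f(v₁,…,vₙ)⟧ is the calculation rule f(x₁,…,xₙ) → y [y = f(x₁,…,xₙ)]
    -- on fresh variables, instantiated by xᵢ ↦ vᵢ and y ↦ ⟦f(v₁,…,vₙ)⟧.
    calc-instance : ∀ f vs → Th f → ¬ Val f → Pointwise ValOfSort vs (arity f) →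
                    RbarInstance (app f (map ⌜_⌝ vs)) ⌜ fJ f vs ⌝
    calc-instance f vs f∈Th f-nonval vs-sorts = record
      { ρ = ρ ; τ = τ ; rrc = inj₂ (calc f xs y f∈Th f-nonval xs-unique y∉xs xs-sorts y-sort)
      ; LV-value = λ z l → zipSubst-value (y-sort ∷ xs-sorts) (w-sort ∷ vs-sorts) (LV-calc l)
      ; non-LV-id = λ z ¬l → zipSubst-outside (y ∷ xs) (w ∷ vs) z (λ m → ¬l (calc-LV m))
      ; valid = Closed⇒Valid (con ρ ⟨ τ ⟩) (ValuedOn-closed (con ρ) (λ x m → proj₁ (zipSubst-value
                  (y-sort ∷ xs-sorts) (w-sort ∷ vs-sorts) (LV-calc (inj₁ m))))) con-holds
      ; lhs≡ = cong (app f) (sym (proj₂ (∷-injective args≡)))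
      ; rhs≡ = sym (proj₁ (∷-injective args≡))
      }
      where
      xs = proj₁ (fresh-vars (arity f))
      xs-unique = proj₁ (proj₂ (fresh-vars (arity f)))
      xs-sorts = proj₂ (proj₂ (fresh-vars (arity f)))
      y = proj₁ (fresh (res f) xs)
      y-sort = proj₁ (proj₂ (fresh (res f) xs))
      y∉xs = proj₂ (proj₂ (fresh (res f) xs))
      w = fJ f vs
      w-sort : ValOfSort w (res f)
      w-sort = fJ-closed f vs f∈Th vs-sorts
      ρ : Rule
      ρ = app f (map var xs) ⟶ var y [ eqₜ (res f) (var y) (app f (map var xs)) ]
      τ = zipSubst (y ∷ xs) (w ∷ vs)

      args≡ : map var (y ∷ xs) ⟨ τ ⟩* ≡ map ⌜_⌝ (w ∷ vs)
      args≡ = zipSubst-var* (All.tabulate (λ m e → y∉xs (subst (_∈ xs) (sym e) m)) ∷ xs-unique)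
                            (y-sort ∷ xs-sorts) (w-sort ∷ vs-sorts)

      LV-calc : ∀ {z} → LV ρ z → z ∈ y ∷ xs
      LV-calc (inj₁ (here e)) = here e
      LV-calc (inj₁ (there m)) with ∈-++⁻ (vars* (map var xs)) m
      ... | inj₁ m' = there (∈-vars-var*⁻ xs m')
      LV-calc (inj₂ (here e , _)) = here e

      calc-LV : ∀ {z} → z ∈ y ∷ xs → LV ρ z
      calc-LV (here e) = inj₁ (here e)
      calc-LV (there m) = inj₁ (there (∈-++⁺ˡ (∈-vars-var*⁺ xs m)))

      con-holds : Eval (con ρ ⟨ τ ⟩) top
      con-holds = subst (λ q → Eval q top)
        (cong₂ (λ a b → eqₜ (res f) a (app f b)) (sym (proj₁ (∷-injective args≡))) (sym (proj₂ (∷-injective args≡))))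
        (subst (Eval _) (proj₂ (eq-sem (res f) w w (proj₁ w-sort) (proj₁ w-sort) (proj₂ w-sort) (proj₂ w-sort)) refl)
          (ev (proj₁ (eq-th (res f) f f∈Th (inj₁ refl))) (Eval-⌜⌝ (proj₁ w-sort) ∷ ev f∈Th (Eval*-⌜⌝ vs-sorts) ∷ [])))

    Rbar-instance : ∀ {ℓ r} → Rbar ℓ r → RbarInstance ℓ r
    Rbar-instance (inst ρ τ r lv nlv valid) = record
      { ρ = ρ ; τ = τ ; rrc = inj₁ r ; LV-value = lv ; non-LV-id = nlv ; valid = valid ; lhs≡ = refl ; rhs≡ = refl }
    Rbar-instance (calc f vs f∈Th f-nonval vs-sorts) = calc-instance f vs f∈Th f-nonval vs-sorts

    -- Instantiating constrained rewriting by solutions of the constraint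

    record Solution (φ : Term) (η : Subst) : Set where
      field
        WS-η : WS η
        valued : ValuedOn η (vars φ)
        holds : Eval (φ ⟨ η ⟩) top

    Inst⇒Solution : ∀ {φ γ θ} → Inst φ γ → WS θ → Solution φ (γ ⨾ θ)
    Inst⇒Solution {φ} {γ} (wγ , (γ-valued , γ-valid) , _) wθ = record
      { WS-η = WS-⨾ wγ wθ
      ; valued = λ x m → IsVal-stable (γ-valued x m)
      ; holds = subst (λ q → Eval q top) (trans (sym (⟨⟩-closed (φ ⟨ γ ⟩) φγ-closed)) (⟨⟩-⨾ φ))
                      (Valid⇒Eval (φ ⟨ γ ⟩) φγ-closed γ-valid)
      }
      where φγ-closed = ValuedOn-closed φ γ-valued

    record Applicable (φ : Term) (ρ : Rule) (σ : Subst) : Set where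
      field
        rrc : Rrc ρ
        WS-σ : WS σ
        LV-ok : LVok φ ρ σ
        implies : Valid (φ ⇒ₜ (con ρ ⟨ σ ⟩))

      LV-value : ∀ {η} → Solution φ η → ∀ x → LV ρ x → IsVal ((σ ⨾ η) x)
      LV-value {η} sol x l with LV-ok x l
      ... | inj₁ v = IsVal-stable v
      ... | inj₂ (y , σx≡y , m) = subst (λ q → IsVal (q ⟨ η ⟩)) (sym σx≡y) (Solution.valued sol y m)

      con-solved : ∀ {η} → Solution φ η → Eval (con ρ ⟨ σ ⨾ η ⟩) top
      con-solved {η} sol =
        subst (λ q → Eval q top) (⟨⟩-⨾ (con ρ))
          (Eval-⇒-elim (implies η WS-η valued-⇒) refl holds
            (λ e → Eval-sort e (∶-⟨⟩ WS-η (∶-⟨⟩ WS-σ (RuleShape.con∶bool (Rrc-shape rrc))))))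
        where
        open Solution sol
        valued-⇒ : ValuedOn η (vars (φ ⇒ₜ (con ρ ⟨ σ ⟩)))
        valued-⇒ z m with ∈-vars-⇒⁻ φ (con ρ ⟨ σ ⟩) m
        ... | inj₁ m′ = valued z m′
        ... | inj₂ m′ with ∈-vars-⟨⟩⁻ (con ρ) m′
        ...   | x , mx , mz with LV-ok x (inj₁ mx)
        ...     | inj₁ v = ⊥-elim (IsVal-closed v z mz)
        ...     | inj₂ (y , e , my) with subst (λ q → z ∈ vars q) e mz
        ...       | here refl = valued z my

    RbarRuleFor : Rule → Subst → Subst → Subst → Set
    RbarRuleFor ρ σ τ η = Σ[ ℓ ∈ Term ] Σ[ r ∈ Term ]
      (Rbar ℓ r × ℓ ⟨ σ ⨾ η ⟩ ≡ lhs ρ ⟨ σ ⟩ ⟨ η ⟩ × r ⟨ τ ⨾ η ⟩ ≡ rhs ρ ⟨ τ ⟩ ⟨ η ⟩)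

    R-rule-for : ∀ {φ ρ σ η} → R ρ → Applicable φ ρ σ → Solution φ η →
                 ∀ τ → (∀ x → LV ρ x → τ x ≡ σ x) → RbarRuleFor ρ σ τ η
    R-rule-for {φ} {ρ} {σ} {η} r A sol τ τ≡σ =
      lhs ρ ⟨ τR ⟩ , rhs ρ ⟨ τR ⟩ ,
      inst ρ τR r (λ x l → subst (λ q → IsVal q × q ∶ vsort x) (sym (select-yes (LV? ρ) l))
                             (value x l , WS-⨾ WS-σ (Solution.WS-η sol) x))
                  (λ x n → select-no (LV? ρ) n)
                  (subst Valid (sym con≡) (Closed⇒Valid (con ρ ⟨ σ ⨾ η ⟩)
                     (ValuedOn-closed (con ρ) (λ x m → value x (inj₁ m))) (con-solved sol))) ,
      trans (⟨⟩-⨾ (lhs ρ)) (trans (⟨⟩-cong (lhs ρ) (τR-absorbed (λ _ _ → refl))) (sym (⟨⟩-⨾ (lhs ρ)))) ,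
      trans (⟨⟩-⨾ (rhs ρ)) (trans (⟨⟩-cong (rhs ρ) (τR-absorbed (λ x l → cong (_⟨ η ⟩) (τ≡σ x l))))
                                  (sym (⟨⟩-⨾ (rhs ρ))))
      where
      open Applicable A
      value = LV-value sol
      τR = select (LV? ρ) (σ ⨾ η) var
      con≡ : con ρ ⟨ τR ⟩ ≡ con ρ ⟨ σ ⨾ η ⟩
      con≡ = ⟨⟩-cong-on (con ρ) (λ x m → select-yes (LV? ρ) (inj₁ m))
      τR-absorbed : ∀ {θ} → (∀ x → LV ρ x → θ x ≡ (σ ⨾ η) x) → ∀ x → (τR ⨾ θ) x ≡ θ x
      τR-absorbed {θ} θ≡ x with LV? ρ x
      ... | yes l = trans (IsVal-⟨⟩ (value x l)) (sym (θ≡ x l))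
      ... | no _ = refl

    var*-⟨⟩ : ∀ xs θ → (map var xs) ⟨ θ ⟩* ≡ map θ xs
    var*-⟨⟩ [] θ = refl
    var*-⟨⟩ (x ∷ xs) θ = cong (θ x ∷_) (var*-⟨⟩ xs θ)

    value-list : ∀ {xs ιs} θ → Pointwise (λ x ι → vsort x ≡ ι) xs ιs → (∀ x → x ∈ xs → IsVal (θ x)) → WS θ →
                 Σ[ vs ∈ List Fun ] (map θ xs ≡ map ⌜_⌝ vs × Pointwise ValOfSort vs ιs)
    value-list θ [] h w = [] , refl , []
    value-list {x ∷ xs} θ (x-sort ∷ p) h w with IsVal-inv (h x (here refl)) | value-list θ p (λ z m → h z (there m)) w
    ... | v , θx≡v , v-val | vs , θxs≡vs , q =
      v ∷ vs , cong₂ _∷_ θx≡v θxs≡vs , (v-val , trans (⌜⌝-sort (subst (_∶ vsort x) θx≡v (w x))) x-sort) ∷ q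

    -- For a calculation rule the solution computes y as f(x₁,…,xₙ), so the
    -- step is the R̄-rule f(v₁,…,vₙ) → ⟦f(v₁,…,vₙ)⟧.
    calc-rule-for : ∀ {φ ρ σ η} → Calc ρ → Applicable φ ρ σ → Solution φ η →
                    ∀ τ → (∀ x → LV ρ x → τ x ≡ σ x) → RbarRuleFor ρ σ τ η
    calc-rule-for {φ} {σ = σ} {η} (calc f xs y f∈Th f-nonval _ _ xs-sorts y-sort) A sol τ τ≡σ =
      app f (map ⌜_⌝ vs) , ⌜ fJ f vs ⌝ , calc f vs f∈Th f-nonval vs-sorts ,
      trans (⟨⟩-closed (app f (map ⌜_⌝ vs)) (⌜⌝*-closed vs))
            (sym (trans (⟨⟩-⨾ (app f (map var xs))) (cong (app f) xs≡vs))) ,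
      sym (trans (cong (_⟨ η ⟩) (τ≡σ y (inj₁ (here refl)))) (trans y≡a (cong ⌜_⌝ a≡w)))
      where
      open Applicable A
      ση = σ ⨾ η
      wση = WS-⨾ WS-σ (Solution.WS-η sol)
      value = LV-value sol
      VL = value-list ση xs-sorts (λ x m → value x (inj₁ (there (∈-++⁺ˡ (∈-vars-var*⁺ xs m))))) wση
      vs = proj₁ VL
      vs-sorts = proj₂ (proj₂ VL)
      xs≡vs : (map var xs) ⟨ ση ⟩* ≡ map ⌜_⌝ vs
      xs≡vs = trans (var*-⟨⟩ xs ση) (proj₁ (proj₂ VL))
      a = proj₁ (IsVal-inv (value y (inj₁ (here refl))))
      y≡a = proj₁ (proj₂ (IsVal-inv (value y (inj₁ (here refl)))))
      a-val = proj₂ (proj₂ (IsVal-inv (value y (inj₁ (here refl)))))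
      a≡w : a ≡ fJ f vs
      a≡w = Eval-eq-elim (con-solved sol) refl
              (subst (λ q → Eval q a) (sym y≡a) (Eval-⌜⌝ a-val))
              (subst (λ q → Eval (app f q) (fJ f vs)) (sym xs≡vs) (ev f∈Th (Eval*-⌜⌝ vs-sorts)))
              (a-val , trans (⌜⌝-sort (subst (_∶ vsort y) y≡a (wση y))) y-sort)
              (fJ-closed f vs f∈Th vs-sorts)

    Rrc-rule-for : ∀ {φ ρ σ η} → Applicable φ ρ σ → Solution φ η →
                   ∀ τ → (∀ x → LV ρ x → τ x ≡ σ x) → RbarRuleFor ρ σ τ η
    Rrc-rule-for A with Applicable.rrc A
    ... | inj₁ r = R-rule-for r A
    ... | inj₂ c = calc-rule-for c A

    lhs-not-value : ∀ {ρ σ v} → Rrc ρ → lhs ρ ⟨ σ ⟩ ≡ ⌜ v ⌝ → Val v → ⊥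
    lhs-not-value {ρ} {σ} rrc e v-val
      with app-injective (trans (sym (cong (_⟨ σ ⟩) (RuleShape.lhs≡ (Rrc-shape rrc)))) e)
    ... | refl , _ = RuleShape.root-nonval (Rrc-shape rrc) v-val

    lhs-not-var : ∀ {ρ σ y} → Rrc ρ → lhs ρ ⟨ σ ⟩ ≢ var y
    lhs-not-var {ρ} {σ} rrc e with trans (sym (cong (_⟨ σ ⟩) (RuleShape.lhs≡ (Rrc-shape rrc)))) e
    ... | ()

    MS-from-value : ∀ {φ s t v} → MS φ s t → s ≡ ⌜ v ⌝ → Val v → t ≡ s
    MS-from-value (mvar x) () v-val
    MS-from-value (mapp f []) e v-val = refl
    MS-from-value (mapp f (_ ∷ _)) () v-val
    MS-from-value (mrule ρ σ τ rrc _ _ _ _ _) e v-val = ⊥-elim (lhs-not-value {ρ} {σ} rrc e v-val)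

    MS-from-var : ∀ {φ s t y} → MS φ s t → s ≡ var y → t ≡ s
    MS-from-var (mvar x) e = refl
    MS-from-var (mapp f _) ()
    MS-from-var (mrule ρ σ τ rrc _ _ _ _ _) e = ⊥-elim (lhs-not-var {ρ} {σ} rrc e)

    mutual
      MS-instance : ∀ {φ s t η} → MS φ s t → Solution φ η → T.MS (s ⟨ η ⟩) (t ⟨ η ⟩)
      MS-instance {η = η} (mvar x) sol = MS-refl (η x)
      MS-instance (mapp f ms) sol = T.mapp f (MS*-instance ms sol)
      MS-instance {η = η} (mrule ρ σ τ rrc wσ lvok _ valid ih) sol =
        let ℓ , r , ℓ→r , ℓ≡ , r≡ = Rrc-rule-for A sol τ τ≡σ
        in subst₂ T.MS ℓ≡ r≡ (T.mrule ℓ r (σ ⨾ η) (τ ⨾ η) ℓ→r (WS-⨾ wσ (Solution.WS-η sol))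
                                       (λ x → MS-instance (ih x) sol))
        where
        A = record { rrc = rrc ; WS-σ = wσ ; LV-ok = lvok ; implies = valid }
        -- on logical variables σ is a value or a variable, which multi-steps only to itself
        τ≡σ : ∀ x → LV ρ x → τ x ≡ σ x
        τ≡σ x l with lvok x l
        ... | inj₁ v = MS-from-value (ih x) (proj₁ (proj₂ (IsVal-inv v))) (proj₂ (proj₂ (IsVal-inv v)))
        ... | inj₂ (y , e , _) = MS-from-var (ih x) e

      MS*-instance : ∀ {φ ss ts η} → MS* φ ss ts → Solution φ η → T.MS* (ss ⟨ η ⟩*) (ts ⟨ η ⟩*)
      MS*-instance [] sol = T.[]
      MS*-instance (m ∷ ms) sol = MS-instance m sol T.∷ MS*-instance ms sol

    CStep-instance : ∀ {φ s t η} → CStep φ s t → Solution φ η → T.Step (s ⟨ η ⟩) (t ⟨ η ⟩)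
    CStep-instance {η = η} (ρ , σ , p , rrc , wσ , at , lvok , _ , valid) sol =
      let ℓ , r , ℓ→r , ℓ≡ , r≡ = Rrc-rule-for A sol σ (λ _ _ → refl)
      in ℓ , r , σ ⨾ η , p , ℓ→r , WS-⨾ wσ (Solution.WS-η sol) ,
         subst₂ (λ a b → At p _ a _ b) (sym ℓ≡) (sym r≡) (At-⟨⟩ at)
      where A = record { rrc = rrc ; WS-σ = wσ ; LV-ok = lvok ; implies = valid }

    -- Closing sequences instantiate to closing sequences of R̄

    open CEq

    MS≥1-instance : ∀ {e e' γ θ} → MS≥1 e e' → Inst (cstr e) γ → WS θ →
      Σ[ γ' ∈ Subst ] (Inst (cstr e') γ' × T.MS (left e ⟨ γ ⟩ ⟨ θ ⟩) (left e' ⟨ γ' ⟩ ⟨ θ ⟩) ×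
                       right e ⟨ γ ⟩ ≡ right e' ⟨ γ' ⟩)
    MS≥1-instance {θ = θ} (s₁ , t₁ , φ₁ , s₂ , e∼ , s₁→s₂ , ∼e') γ-inst wθ =
      let δ , δ-inst , l≡ , r≡ = proj₁ e∼ _ γ-inst
          γ' , γ'-inst , l≡′ , r≡′ = proj₁ ∼e' δ δ-inst
      in γ' , γ'-inst ,
         subst₂ T.MS (trans (sym (⟨⟩-⨾ s₁ {δ} {θ})) (cong (_⟨ θ ⟩) (sym l≡)))
                     (trans (sym (⟨⟩-⨾ s₂ {δ} {θ})) (cong (_⟨ θ ⟩) l≡′))
                (MS-instance s₁→s₂ (Inst⇒Solution {φ₁} {δ} {θ} δ-inst wθ)) ,
         trans r≡ r≡′

    Step≥2-instance : ∀ {e e' γ θ} → Step≥2 e e' → Inst (cstr e) γ → WS θ →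
      Σ[ γ' ∈ Subst ] (Inst (cstr e') γ' × left e ⟨ γ ⟩ ≡ left e' ⟨ γ' ⟩ ×
                       T.Step (right e ⟨ γ ⟩ ⟨ θ ⟩) (right e' ⟨ γ' ⟩ ⟨ θ ⟩))
    Step≥2-instance {θ = θ} (s₁ , t₁ , φ₁ , t₂ , e∼ , t₁→t₂ , ∼e') γ-inst wθ =
      let δ , δ-inst , l≡ , r≡ = proj₁ e∼ _ γ-inst
          γ' , γ'-inst , l≡′ , r≡′ = proj₁ ∼e' δ δ-inst
      in γ' , γ'-inst , trans l≡ l≡′ ,
         subst₂ T.Step (trans (sym (⟨⟩-⨾ t₁ {δ} {θ})) (cong (_⟨ θ ⟩) (sym r≡)))
                       (trans (sym (⟨⟩-⨾ t₂ {δ} {θ})) (cong (_⟨ θ ⟩) r≡′))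
                (CStep-instance {φ₁} {t₁} {t₂} t₁→t₂ (Inst⇒Solution {φ₁} {δ} {θ} δ-inst wθ))

    Star-Step≥2-instance : ∀ {e e' γ θ} → Star Step≥2 e e' → Inst (cstr e) γ → WS θ →
      Σ[ γ' ∈ Subst ] (Inst (cstr e') γ' × left e ⟨ γ ⟩ ≡ left e' ⟨ γ' ⟩ ×
                       Star T.Step (right e ⟨ γ ⟩ ⟨ θ ⟩) (right e' ⟨ γ' ⟩ ⟨ θ ⟩))
    Star-Step≥2-instance ε γ-inst wθ = _ , γ-inst , refl , ε
    Star-Step≥2-instance {e} {e'} {γ} {θ} (_◅_ {j = e₁} step steps) γ-inst wθ =
      let γ₁ , γ₁-inst , l≡₁ , r→r₁ = Step≥2-instance {e} {e₁} {γ} {θ} step γ-inst wθ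
          γ₂ , γ₂-inst , l≡₂ , r₁→*r₂ = Star-Step≥2-instance {e₁} {e'} {γ₁} {θ} steps γ₁-inst wθ
      in γ₂ , γ₂-inst , trans l≡₁ l≡₂ , r→r₁ ◅ r₁→*r₂

    Trivial-instance : ∀ {e γ θ} → Trivial e → Inst (cstr e) γ → WS θ →
                       left e ⟨ γ ⟩ ⟨ θ ⟩ ≡ right e ⟨ γ ⟩ ⟨ θ ⟩
    Trivial-instance {e} {γ} {θ} trivial (wγ , (γ-valued , γ-valid) , _) wθ =
      trans (⟨⟩-⨾ (left e)) (trans (trivial (γ ⨾ θ) (WS-⨾ wγ wθ) (valued , valid)) (sym (⟨⟩-⨾ (right e))))
      where
      ψγ-closed = ValuedOn-closed (cstr e) γ-valued
      valued : ValuedOn (γ ⨾ θ) (vars (cstr e))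
      valued x m = IsVal-stable (γ-valued x m)
      valid : Valid (cstr e ⟨ γ ⨾ θ ⟩)
      valid = subst Valid (trans (sym (⟨⟩-closed (cstr e ⟨ γ ⟩) ψγ-closed)) (⟨⟩-⨾ (cstr e))) γ-valid

    ADC-CP-instance : ∀ {p s t} (e : CEq) → ADC-CP p e → ∀ γ θ → Inst (cstr e) γ → WS θ →
                      left e ⟨ γ ⟩ ⟨ θ ⟩ ≡ s → right e ⟨ γ ⟩ ⟨ θ ⟩ ≡ t →
                      (p ≢ [] → T.MS s t) × (p ≡ [] → Σ[ w ∈ Term ] (T.MS s w × Star T.Step t w))
    ADC-CP-instance {p} {s} {t} e closed γ θ γ-inst wθ s≡ t≡ = inner , overlay
      where
      inner : p ≢ [] → T.MS s t
      inner p≢[] =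
        let e' , e→e' , trivial = proj₁ closed p≢[]
            γ' , γ'-inst , s→ , r≡ = MS≥1-instance {e} {e'} {γ} {θ} e→e' γ-inst wθ
        in subst₂ T.MS s≡ (trans (Trivial-instance {e'} trivial γ'-inst wθ) (trans (cong (_⟨ θ ⟩) (sym r≡)) t≡)) s→
      overlay : p ≡ [] → Σ[ w ∈ Term ] (T.MS s w × Star T.Step t w)
      overlay p≡[] =
        let e' , e'' , e→e' , e'→*e'' , trivial = proj₂ closed p≡[]
            γ' , γ'-inst , s→ , r≡ = MS≥1-instance {e} {e'} {γ} {θ} e→e' γ-inst wθ
            γ'' , γ''-inst , l≡ , t→* = Star-Step≥2-instance {e'} {e''} {γ'} {θ} e'→*e'' γ'-inst wθ
        in left e' ⟨ γ' ⟩ ⟨ θ ⟩ , subst (λ q → T.MS q _) s≡ s→ ,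
           subst₂ (Star T.Step) (trans (cong (_⟨ θ ⟩) (sym r≡)) t≡)
                  (trans (sym (Trivial-instance {e''} trivial γ''-inst wθ)) (cong (_⟨ θ ⟩) (sym l≡))) t→*

    -- Every critical pair of R̄ is an instance of a constrained critical pair

    module Lift {p s t} (cp : T.CP p s t) where
      module C = T.CP cp
      inst₁ = Rbar-instance C.rule₁
      inst₂ = Rbar-instance C.rule₂
      open RbarInstance inst₁ using () renaming (ρ to ρ₁; τ to τ₁)
      open RbarInstance inst₂ using () renaming (ρ to ρ₂⁰; τ to τ₂)
      π₁ = proj₁ C.var₁
      π₂ = proj₁ C.var₂
      P = proj₁ (fresh-renaming (ruleVars ρ₂⁰) (ruleVars ρ₁))
      P-fresh = proj₂ (fresh-renaming (ruleVars ρ₂⁰) (ruleVars ρ₁))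
      ρ₂ = rename ρ₂⁰ P
      σ = C.σ

      P⁻-in-ρ₂⁰? : ∀ z → Dec (π⁻ P z ∈ ruleVars ρ₂⁰)
      P⁻-in-ρ₂⁰? z = π⁻ P z ∈? ruleVars ρ₂⁰

      -- α sends the two (now variable-disjoint) rules onto the two rules of the critical pair.
      α : Subst
      α = select P⁻-in-ρ₂⁰? (λ z → τ₂ (π⁻ P z) ⟨ ren π₂ ⟩) (τ₁ ⨾ ren π₁)

      α-ρ₁ : ∀ z → z ∈ ruleVars ρ₁ → α z ≡ τ₁ z ⟨ ren π₁ ⟩
      α-ρ₁ z m = select-no P⁻-in-ρ₂⁰? (λ m' → P-fresh (π⁻ P z) m' (subst (_∈ ruleVars ρ₁) (sym (inv₂ P z)) m))

      α-ρ₂ : ∀ z → π⁻ P z ∈ ruleVars ρ₂⁰ → α z ≡ τ₂ (π⁻ P z) ⟨ ren π₂ ⟩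
      α-ρ₂ z m = select-yes P⁻-in-ρ₂⁰? m

      α-ρ₂⁰ : ∀ x → x ∈ ruleVars ρ₂⁰ → α (π P x) ≡ τ₂ x ⟨ ren π₂ ⟩
      α-ρ₂⁰ x m = trans (α-ρ₂ (π P x) (subst (_∈ ruleVars ρ₂⁰) (sym (inv₁ P x)) m))
                        (cong (λ w → τ₂ w ⟨ ren π₂ ⟩) (inv₁ P x))

      α-WS : WS α
      α-WS = select-preserves P⁻-in-ρ₂⁰? (λ z q → q ∶ vsort z)
               (λ z → subst (τ₂ (π⁻ P z) ⟨ ren π₂ ⟩ ∶_) (sorted (P ⁻¹ʳ) z)
                        (∶-⟨⟩ (WS-ren π₂) (RbarInstance.τ-WS inst₂ (π⁻ P z))))
               (λ z → ∶-⟨⟩ (WS-ren π₁) (RbarInstance.τ-WS inst₁ z))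

      α-ValOrVar : ∀ z → ValOrVar (α z)
      α-ValOrVar = select-preserves P⁻-in-ρ₂⁰? (λ _ → ValOrVar)
                     (λ z → ValOrVar-ren π₂ (RbarInstance.τ-value-or-var inst₂ (π⁻ P z)))
                     (λ z → ValOrVar-ren π₁ (RbarInstance.τ-value-or-var inst₁ z))

      α-on-ρ₁ : ∀ t → (∀ x → x ∈ vars t → x ∈ ruleVars ρ₁) → t ⟨ α ⟩ ≡ t ⟨ τ₁ ⟩ ⟨ ren π₁ ⟩
      α-on-ρ₁ t ⊆ρ₁ = trans (⟨⟩-cong-on t (λ x m → α-ρ₁ x (⊆ρ₁ x m))) (sym (⟨⟩-⨾ t))

      α-on-ρ₂ : ∀ t → (∀ x → x ∈ vars t → x ∈ ruleVars ρ₂⁰) → t ⟨ ren P ⟩ ⟨ α ⟩ ≡ t ⟨ τ₂ ⟩ ⟨ ren π₂ ⟩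
      α-on-ρ₂ t ⊆ρ₂ = trans (⟨⟩-⨾ t) (trans (⟨⟩-cong-on t (λ x m → α-ρ₂⁰ x (⊆ρ₂ x m))) (sym (⟨⟩-⨾ t)))

      ℓ₁≡ : lhs ρ₁ ⟨ α ⟩ ≡ C.ℓ₁
      ℓ₁≡ = trans (α-on-ρ₁ (lhs ρ₁) (λ x → ∈-ruleVars-lhs ρ₁))
                  (trans (cong (_⟨ ren π₁ ⟩) (sym (RbarInstance.lhs≡ inst₁))) (sym (proj₁ (proj₂ C.var₁))))
      r₁≡ : rhs ρ₁ ⟨ α ⟩ ≡ C.r₁
      r₁≡ = trans (α-on-ρ₁ (rhs ρ₁) (λ x → ∈-ruleVars-rhs ρ₁))
                  (trans (cong (_⟨ ren π₁ ⟩) (sym (RbarInstance.rhs≡ inst₁))) (sym (proj₂ (proj₂ C.var₁))))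
      ℓ₂≡ : lhs ρ₂ ⟨ α ⟩ ≡ C.ℓ₂
      ℓ₂≡ = trans (α-on-ρ₂ (lhs ρ₂⁰) (λ x → ∈-ruleVars-lhs ρ₂⁰))
                  (trans (cong (_⟨ ren π₂ ⟩) (sym (RbarInstance.lhs≡ inst₂))) (sym (proj₁ (proj₂ C.var₂))))
      r₂≡ : rhs ρ₂ ⟨ α ⟩ ≡ C.r₂
      r₂≡ = trans (α-on-ρ₂ (rhs ρ₂⁰) (λ x → ∈-ruleVars-rhs ρ₂⁰))
                  (trans (cong (_⟨ ren π₂ ⟩) (sym (RbarInstance.rhs≡ inst₂))) (sym (proj₂ (proj₂ C.var₂))))

      θ : Subst
      θ = α ⨾ σ

      θ-WS : WS θ
      θ-WS = WS-⨾ α-WS (proj₁ C.mgu)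

      θ-unifies : lhs ρ₁ ⟨ θ ⟩ ≡ C.u ⟨ σ ⟩
      θ-unifies = trans (sym (⟨⟩-⨾ (lhs ρ₁))) (trans (cong (_⟨ σ ⟩) ℓ₁≡) (proj₁ (proj₂ C.mgu)))

      -- The overlapped subterm u of ℓ₂ is not inside the image of α (values and
      -- variables), so it is the α-instance of a non-variable subterm of lhs ρ₂.
      u-not-value : ∀ v → Val v → C.u ≢ ⌜ v ⌝
      u-not-value v v-val u≡v = lhs-not-value {ρ₁} {θ} (RbarInstance.rrc inst₁) (trans θ-unifies (cong (_⟨ σ ⟩) u≡v)) v-val

      u-not-in-α : ∀ {x q s′} → At q (α x) C.u s′ C.u → ⊥
      u-not-in-α {x} {q} {s′} at with α-ValOrVar x
      ... | inj₂ (y , αx≡y) = C.u-nv y (At-var (subst (λ w → At q w C.u s′ C.u) αx≡y at))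
      ... | inj₁ v with IsVal-inv v
      ...   | w , αx≡w , w-val = u-not-value w w-val (At-⌜⌝ (subst (λ w′ → At q w′ C.u s′ C.u) αx≡w at))

      u-pattern : Σ[ u′ ∈ Term ] (At p (lhs ρ₂) u′ (lhs ρ₂) u′ × C.u ≡ u′ ⟨ α ⟩)
      u-pattern with At-⟨⟩⁻ (lhs ρ₂) (subst (λ q → At p q C.u q C.u) (sym ℓ₂≡) C.u-at)
      ... | inj₁ found = found
      ... | inj₂ (x , q , s′ , _ , at) = ⊥-elim (u-not-in-α at)

      u′ = proj₁ u-pattern
      u′-at = proj₁ (proj₂ u-pattern)
      u≡u′α = proj₂ (proj₂ u-pattern)

      u′-nonvar : NonVar u′
      u′-nonvar z u′≡z = u-not-in-α (subst (λ w → At [] w C.u w C.u) (trans u≡u′α (cong (_⟨ α ⟩) u′≡z)) here)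

      θ-unifies′ : lhs ρ₁ ⟨ θ ⟩ ≡ u′ ⟨ θ ⟩
      θ-unifies′ = trans θ-unifies (trans (cong (_⟨ σ ⟩) u≡u′α) (⟨⟩-⨾ u′))

      mgu-exists : Σ[ σ′ ∈ Subst ] (MGU σ′ (lhs ρ₁) u′ × MostGeneral ((lhs ρ₁ , u′) ∷ []) σ′)
      mgu-exists = MGU-exists (lhs ρ₁) u′ ℓ₁∶ (subst (u′ ∶_) (sym same-sort) (proj₂ u′-sort)) θ θ-WS θ-unifies′
        where
        ℓ₁∶ = RuleShape.lhs∶ (Rrc-shape (RbarInstance.rrc inst₁))
        u′-sort = At-sort u′-at (∶-⟨⟩ (WS-ren P) (RuleShape.lhs∶ (Rrc-shape (RbarInstance.rrc inst₂))))
        same-sort : RuleShape.sort (Rrc-shape (RbarInstance.rrc inst₁)) ≡ proj₁ u′-sort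
        same-sort = ∶-unique (∶-⟨⟩ θ-WS ℓ₁∶)
                      (subst (_∶ proj₁ u′-sort) (sym θ-unifies′) (∶-⟨⟩ θ-WS (proj₂ u′-sort)))

      module WithMGU (σ′ : Subst) (σ′-mgu : MGU σ′ (lhs ρ₁) u′)
                     (σ′-general : MostGeneral ((lhs ρ₁ , u′) ∷ []) σ′) where

        θ-factors : ∀ x → θ x ≡ σ′ x ⟨ θ ⟩
        θ-factors = σ′-general θ (θ-unifies′ , tt)

        σ′-absorbed : ∀ t → t ⟨ σ′ ⟩ ⟨ θ ⟩ ≡ t ⟨ θ ⟩
        σ′-absorbed t = trans (⟨⟩-⨾ t) (⟨⟩-cong t (λ x → sym (θ-factors x)))

        ρ₂-variant : VariantBy P ρ₂⁰ ρ₂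
        ρ₂-variant = variant-by refl refl refl

        LV-α-value : ∀ x → LV ρ₁ x ⊎ LV ρ₂ x → IsVal (α x)
        LV-α-value x (inj₁ l) =
          subst IsVal (sym (trans (α-ρ₁ x (LV⊆ruleVars ρ₁ l)) (IsVal-⟨⟩ v))) v
          where v = proj₁ (RbarInstance.LV-value inst₁ x l)
        LV-α-value x (inj₂ l) =
          subst IsVal (sym (trans (α-ρ₂ x (LV⊆ruleVars ρ₂⁰ l⁰)) (IsVal-⟨⟩ v))) v
          where
          l⁰ = LV-variant⁻ ρ₂-variant l
          v = proj₁ (RbarInstance.LV-value inst₂ _ l⁰)

        LV-θ-value : ∀ x → LV ρ₁ x ⊎ LV ρ₂ x → IsVal (θ x)
        LV-θ-value x l = IsVal-stable (LV-α-value x l)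

        LV-σ′ : ∀ x → LV ρ₁ x ⊎ LV ρ₂ x → ValOrVar (σ′ x)
        LV-σ′ x l with IsVal-inv (LV-θ-value x l)
        ... | v , θx≡v , v-val = ValOrVar-instance (σ′ x) (trans (sym (θ-factors x)) θx≡v) v-val

        LV-valued : ∀ t → (∀ x → x ∈ vars t → LV ρ₁ x ⊎ LV ρ₂ x) → ValuedOn θ (vars (t ⟨ σ′ ⟩))
        LV-valued t ⊆LV z m with ∈-vars-⟨⟩⁻ t m
        ... | x , mx , mz with LV-σ′ x (⊆LV x mx)
        ...   | inj₁ v = ⊥-elim (IsVal-closed v z mz)
        ...   | inj₂ (y , σ′x≡y) with subst (λ q → z ∈ vars q) σ′x≡y mz
        ...     | here refl = subst IsVal (trans (θ-factors x) (cong (_⟨ θ ⟩) σ′x≡y)) (LV-θ-value x (⊆LV x mx))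

        con₁-holds : Eval (con ρ₁ ⟨ θ ⟩) top
        con₁-holds = subst (λ q → Eval q top) (sym con₁≡) (Valid⇒Eval _ closed (RbarInstance.valid inst₁))
          where
          open ≡-Reasoning
          closed = RbarInstance.con-closed inst₁
          con₁≡ : con ρ₁ ⟨ θ ⟩ ≡ con ρ₁ ⟨ τ₁ ⟩
          con₁≡ = begin
            con ρ₁ ⟨ θ ⟩                    ≡⟨ ⟨⟩-⨾ (con ρ₁) ⟨
            con ρ₁ ⟨ α ⟩ ⟨ σ ⟩              ≡⟨ cong (_⟨ σ ⟩) (α-on-ρ₁ (con ρ₁) (λ x → ∈-ruleVars-con ρ₁)) ⟩
            con ρ₁ ⟨ τ₁ ⟩ ⟨ ren π₁ ⟩ ⟨ σ ⟩  ≡⟨ cong (_⟨ σ ⟩) (⟨⟩-closed (con ρ₁ ⟨ τ₁ ⟩) closed) ⟩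
            con ρ₁ ⟨ τ₁ ⟩ ⟨ σ ⟩             ≡⟨ ⟨⟩-closed (con ρ₁ ⟨ τ₁ ⟩) closed ⟩
            con ρ₁ ⟨ τ₁ ⟩                   ∎

        con₂-holds : Eval (con ρ₂ ⟨ θ ⟩) top
        con₂-holds = subst (λ q → Eval q top) (sym con₂≡) (Valid⇒Eval _ closed (RbarInstance.valid inst₂))
          where
          open ≡-Reasoning
          closed = RbarInstance.con-closed inst₂
          con₂≡ : con ρ₂ ⟨ θ ⟩ ≡ con ρ₂⁰ ⟨ τ₂ ⟩
          con₂≡ = begin
            con ρ₂ ⟨ θ ⟩                    ≡⟨ ⟨⟩-⨾ (con ρ₂) ⟨
            con ρ₂ ⟨ α ⟩ ⟨ σ ⟩              ≡⟨ cong (_⟨ σ ⟩) (α-on-ρ₂ (con ρ₂⁰) (λ x → ∈-ruleVars-con ρ₂⁰)) ⟩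
            con ρ₂⁰ ⟨ τ₂ ⟩ ⟨ ren π₂ ⟩ ⟨ σ ⟩ ≡⟨ cong (_⟨ σ ⟩) (⟨⟩-closed (con ρ₂⁰ ⟨ τ₂ ⟩) closed) ⟩
            con ρ₂⁰ ⟨ τ₂ ⟩ ⟨ σ ⟩            ≡⟨ ⟨⟩-closed (con ρ₂⁰ ⟨ τ₂ ⟩) closed ⟩
            con ρ₂⁰ ⟨ τ₂ ⟩                  ∎

        Φ : Term
        Φ = con ρ₁ ∧ₜ (con ρ₂ ∧ₜ (EC ρ₁ ∧ₜ EC ρ₂))

        Φ-vars : ∀ x → x ∈ vars Φ → LV ρ₁ x ⊎ LV ρ₂ x
        Φ-vars x m with ∈-vars-∧⁻ (con ρ₁) (con ρ₂ ∧ₜ (EC ρ₁ ∧ₜ EC ρ₂)) m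
        ... | inj₁ m₁ = inj₁ (inj₁ m₁)
        ... | inj₂ m′ with ∈-vars-∧⁻ (con ρ₂) (EC ρ₁ ∧ₜ EC ρ₂) m′
        ...   | inj₁ m₂ = inj₂ (inj₁ m₂)
        ...   | inj₂ m″ with ∈-vars-∧⁻ (EC ρ₁) (EC ρ₂) m″
        ...     | inj₁ m₃ = inj₁ (EC-vars⊆LV ρ₁ m₃)
        ...     | inj₂ m₃ = inj₂ (EC-vars⊆LV ρ₂ m₃)

        Φ-holds : Eval (Φ ⟨ θ ⟩) top
        Φ-holds = Eval-∧-intro con₁-holds (Eval-∧-intro con₂-holds (Eval-∧-intro
                    (Eval-EC ρ₁ (λ x l → LV-θ-value x (inj₁ l)) θ-WS)
                    (Eval-EC ρ₂ (λ x l → LV-θ-value x (inj₂ l)) θ-WS)))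

        cons-satisfiable : Sat ((con ρ₁ ∧ₜ con ρ₂) ⟨ σ′ ⟩)
        cons-satisfiable = θ , θ-WS , valued ,
          Closed⇒Valid _ (ValuedOn-closed ((con ρ₁ ∧ₜ con ρ₂) ⟨ σ′ ⟩) valued)
            (subst (λ q → Eval q top) (sym (σ′-absorbed (con ρ₁ ∧ₜ con ρ₂))) (Eval-∧-intro con₁-holds con₂-holds))
          where
          valued = LV-valued (con ρ₁ ∧ₜ con ρ₂) (λ x m → Sum.map inj₁ inj₁ (∈-vars-∧⁻ (con ρ₁) (con ρ₂) m))

        variant-instance : p ≡ [] → (∀ x → x ∈ vars (rhs ρ₁) → x ∈ vars (lhs ρ₁)) → Variant ρ₁ ρ₂ →
                           T.VariantT C.ℓ₁ C.r₁ C.ℓ₂ C.r₂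
        variant-instance p≡[] rhs⊆lhs (πv , l≡ , r≡ , c≡) = Π , ℓ₂-variant , r₂-variant
          where
          open ≡-Reasoning
          ρ₁→ρ₂ : VariantBy πv ρ₁ ρ₂
          ρ₁→ρ₂ = variant-by l≡ r≡ c≡
          Π : Renaming
          Π = π₁ ⁻¹ʳ ⨾ʳ πv ⨾ʳ P ⁻¹ʳ ⨾ʳ π₂

          u≡ℓ₂ : C.u ≡ C.ℓ₂
          u≡ℓ₂ = At-root (subst (λ q → At q C.ℓ₂ C.u C.ℓ₂ C.u) p≡[] C.u-at)

          θ-agrees : lhs ρ₁ ⟨ θ ⟩ ≡ lhs ρ₁ ⟨ (ren πv ⨾ α) ⨾ σ ⟩
          θ-agrees = begin
            lhs ρ₁ ⟨ θ ⟩                        ≡⟨ θ-unifies ⟩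
            C.u ⟨ σ ⟩                           ≡⟨ cong (_⟨ σ ⟩) (trans u≡ℓ₂ (sym ℓ₂≡)) ⟩
            lhs ρ₂ ⟨ α ⟩ ⟨ σ ⟩                  ≡⟨ cong (λ q → q ⟨ α ⟩ ⟨ σ ⟩) l≡ ⟩
            lhs ρ₁ ⟨ ren πv ⟩ ⟨ α ⟩ ⟨ σ ⟩       ≡⟨ cong (_⟨ σ ⟩) (⟨⟩-⨾ (lhs ρ₁)) ⟩
            lhs ρ₁ ⟨ ren πv ⨾ α ⟩ ⟨ σ ⟩         ≡⟨ ⟨⟩-⨾ (lhs ρ₁) ⟩
            lhs ρ₁ ⟨ (ren πv ⨾ α) ⨾ σ ⟩         ∎

          α-commutes : ∀ x → x ∈ vars (lhs ρ₁) → α (π πv x) ≡ α x ⟨ ren Π ⟩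
          α-commutes x m with LV? ρ₁ x
          ... | yes l = begin
            α (π πv x)              ≡⟨ IsVal-⟨⟩ (LV-α-value (π πv x) (inj₂ (LV-variant⁺ ρ₁→ρ₂ l))) ⟨
            α (π πv x) ⟨ σ ⟩        ≡⟨ ⟨⟩-agree (lhs ρ₁) θ-agrees x m ⟨
            α x ⟨ σ ⟩               ≡⟨ IsVal-⟨⟩ (LV-α-value x (inj₁ l)) ⟩
            α x                     ≡⟨ IsVal-⟨⟩ (LV-α-value x (inj₁ l)) ⟨
            α x ⟨ ren Π ⟩           ∎
          ... | no ¬l = begin
            α (π πv x)              ≡⟨ α-ρ₂ (π πv x) w∈ρ₂⁰ ⟩
            τ₂ w ⟨ ren π₂ ⟩         ≡⟨ cong (_⟨ ren π₂ ⟩) (RbarInstance.non-LV-id inst₂ w ¬LV-w) ⟩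
            var (π π₂ w)            ≡⟨ cong (λ q → var (π π₂ (π⁻ P (π πv q)))) (inv₁ π₁ x) ⟨
            var (π π₁ x) ⟨ ren Π ⟩  ≡⟨ cong (λ q → q ⟨ ren π₁ ⟩ ⟨ ren Π ⟩) (RbarInstance.non-LV-id inst₁ x ¬l) ⟨
            τ₁ x ⟨ ren π₁ ⟩ ⟨ ren Π ⟩ ≡⟨ cong (_⟨ ren Π ⟩) (α-ρ₁ x (∈-ruleVars-lhs ρ₁ m)) ⟨
            α x ⟨ ren Π ⟩           ∎
            where
            w = π⁻ P (π πv x)
            w∈ρ₂⁰ : w ∈ ruleVars ρ₂⁰
            w∈ρ₂⁰ = ∈-ruleVars-rename⁻ ρ₂⁰ P (∈-ruleVars-lhs ρ₂
                      (subst (λ q → π πv x ∈ vars q) (sym l≡) (∈-vars-ren⁺ {πv} {lhs ρ₁} m)))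
            ¬LV-w : ¬ LV ρ₂⁰ w
            ¬LV-w l = ¬l (subst (LV ρ₁) (inv₁ πv x)
                        (LV-variant⁻ ρ₁→ρ₂ (subst (LV ρ₂) (inv₂ P (π πv x)) (LV-variant⁺ ρ₂-variant l))))

          variant-on : ∀ t → (∀ x → x ∈ vars t → x ∈ vars (lhs ρ₁)) → t ⟨ ren πv ⟩ ⟨ α ⟩ ≡ t ⟨ α ⟩ ⟨ ren Π ⟩
          variant-on t ⊆lhs = begin
            t ⟨ ren πv ⟩ ⟨ α ⟩      ≡⟨ ⟨⟩-⨾ t ⟩
            t ⟨ ren πv ⨾ α ⟩        ≡⟨ ⟨⟩-cong-on t (λ x m → α-commutes x (⊆lhs x m)) ⟩
            t ⟨ α ⨾ ren Π ⟩         ≡⟨ ⟨⟩-⨾ t ⟨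
            t ⟨ α ⟩ ⟨ ren Π ⟩       ∎

          ℓ₂-variant : C.ℓ₂ ≡ C.ℓ₁ ⟨ ren Π ⟩
          ℓ₂-variant = begin
            C.ℓ₂                          ≡⟨ ℓ₂≡ ⟨
            lhs ρ₂ ⟨ α ⟩                  ≡⟨ cong (_⟨ α ⟩) l≡ ⟩
            lhs ρ₁ ⟨ ren πv ⟩ ⟨ α ⟩       ≡⟨ variant-on (lhs ρ₁) (λ x m → m) ⟩
            lhs ρ₁ ⟨ α ⟩ ⟨ ren Π ⟩        ≡⟨ cong (_⟨ ren Π ⟩) ℓ₁≡ ⟩
            C.ℓ₁ ⟨ ren Π ⟩                ∎

          r₂-variant : C.r₂ ≡ C.r₁ ⟨ ren Π ⟩
          r₂-variant = begin
            C.r₂                          ≡⟨ r₂≡ ⟨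
            rhs ρ₂ ⟨ α ⟩                  ≡⟨ cong (_⟨ α ⟩) r≡ ⟩
            rhs ρ₁ ⟨ ren πv ⟩ ⟨ α ⟩       ≡⟨ variant-on (rhs ρ₁) rhs⊆lhs ⟩
            rhs ρ₁ ⟨ α ⟩ ⟨ ren Π ⟩        ≡⟨ cong (_⟨ ren Π ⟩) r₁≡ ⟩
            C.r₁ ⟨ ren Π ⟩                ∎

        root-condition : p ≡ [] → ¬ Variant ρ₁ ρ₂ ⊎ ¬ (∀ x → x ∈ vars (rhs ρ₁) → x ∈ vars (lhs ρ₁))
        root-condition p≡[] with vars (rhs ρ₁) ⊆? vars (lhs ρ₁)
        ... | no ¬⊆ = inj₂ (λ ⊆ → ¬⊆ (λ {x} → ⊆ x))
        ... | yes ⊆ = inj₁ (λ v → C.root p≡[] (variant-instance p≡[] (λ x → ⊆) v))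

        s′ = proj₁ (At-replace u′-at (rhs ρ₁))
        s′-at = proj₂ (At-replace u′-at (rhs ρ₁))

        constrained-pair : CEq
        constrained-pair = s′ ⟨ σ′ ⟩ ≈ rhs ρ₂ ⟨ σ′ ⟩ [ Φ ⟨ σ′ ⟩ ]

        is-CCP : CCP p constrained-pair
        is-CCP = record
          { ρ₁ = ρ₁ ; ρ₂ = ρ₂ ; ρ₁⁰ = ρ₁ ; ρ₂⁰ = ρ₂⁰
          ; ρ₁⁰∈ = RbarInstance.rrc inst₁ ; ρ₂⁰∈ = RbarInstance.rrc inst₂
          ; var₁ = idʳ , sym (⟨⟩-identity (lhs ρ₁)) , sym (⟨⟩-identity (rhs ρ₁)) , sym (⟨⟩-identity (con ρ₁))
          ; var₂ = P , refl , refl , refl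
          ; disj = λ x m₁ m₂ → P-fresh (π⁻ P x) (∈-ruleVars-rename⁻ ρ₂⁰ P m₂)
                                       (subst (_∈ ruleVars ρ₁) (sym (inv₂ P x)) m₁)
          ; u = u′ ; u-at = u′-at ; u-nv = u′-nonvar
          ; σ = σ′ ; mgu = σ′-mgu
          ; σ-ok = λ x l → LV-σ′ x l
          ; sat = cons-satisfiable ; root = root-condition
          ; lft = At-⟨⟩ s′-at ; rgt = refl ; cst = refl
          }

        Φσ′-vars? : ∀ z → Dec (z ∈ vars (Φ ⟨ σ′ ⟩))
        Φσ′-vars? z = z ∈? vars (Φ ⟨ σ′ ⟩)

        γ : Subst
        γ = select Φσ′-vars? θ var

        γ-inst : Inst (Φ ⟨ σ′ ⟩) γ
        γ-inst = select-preserves Φσ′-vars? (λ z q → q ∶ vsort z) θ-WS var∶ ,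
                 ((λ z m → subst IsVal (sym (select-yes Φσ′-vars? m)) (Φ-valued z m)) ,
                  subst Valid (sym (trans (⟨⟩-cong-on (Φ ⟨ σ′ ⟩) (λ z m → select-yes Φσ′-vars? m)) (σ′-absorbed Φ)))
                    (Closed⇒Valid (Φ ⟨ θ ⟩) (ValuedOn-closed Φ (λ x m → LV-θ-value x (Φ-vars x m))) Φ-holds)) ,
                 (λ z ∉ → select-no Φσ′-vars? ∉)
          where Φ-valued = LV-valued Φ Φ-vars

        γθ≡θ : ∀ t → t ⟨ σ′ ⟩ ⟨ γ ⟩ ⟨ θ ⟩ ≡ t ⟨ θ ⟩
        γθ≡θ t = trans (⟨⟩-⨾ (t ⟨ σ′ ⟩)) (trans (⟨⟩-cong (t ⟨ σ′ ⟩) absorbed) (σ′-absorbed t))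
          where
          absorbed : ∀ z → (γ ⨾ θ) z ≡ θ z
          absorbed z with Φσ′-vars? z
          ... | yes m = IsVal-⟨⟩ (LV-valued Φ Φ-vars z m)
          ... | no _ = refl

        left-instance : s′ ⟨ σ′ ⟩ ⟨ γ ⟩ ⟨ θ ⟩ ≡ s
        left-instance = trans (γθ≡θ s′)
          (At-functional (At-cong ℓ₂θ u′θ r₁θ (At-⟨⟩ {σ = θ} s′-at)) C.lft)
          where
          ℓ₂θ : lhs ρ₂ ⟨ θ ⟩ ≡ C.ℓ₂ ⟨ σ ⟩
          ℓ₂θ = trans (sym (⟨⟩-⨾ (lhs ρ₂))) (cong (_⟨ σ ⟩) ℓ₂≡)
          u′θ : u′ ⟨ θ ⟩ ≡ C.u ⟨ σ ⟩
          u′θ = trans (sym (⟨⟩-⨾ u′)) (cong (_⟨ σ ⟩) (sym u≡u′α))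
          r₁θ : rhs ρ₁ ⟨ θ ⟩ ≡ C.r₁ ⟨ σ ⟩
          r₁θ = trans (sym (⟨⟩-⨾ (rhs ρ₁))) (cong (_⟨ σ ⟩) r₁≡)

        right-instance : rhs ρ₂ ⟨ σ′ ⟩ ⟨ γ ⟩ ⟨ θ ⟩ ≡ t
        right-instance =
          trans (γθ≡θ (rhs ρ₂)) (trans (sym (⟨⟩-⨾ (rhs ρ₂))) (trans (cong (_⟨ σ ⟩) r₂≡) (sym C.rgt)))

    AlmostDevClosed-Rbar : AlmostDevClosed → T.AlmostDevClosed
    AlmostDevClosed-Rbar adc p s t cp =
      ADC-CP-instance constrained-pair (adc p constrained-pair is-CCP) γ θ γ-inst θ-WS left-instance right-instance
      where
      open Lift cp
      open WithMGU (proj₁ mgu-exists) (proj₁ (proj₂ mgu-exists)) (proj₂ (proj₂ mgu-exists))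

theorem5 : (S : Setting) (R : Theory.Rule S → Set) →
           Theory.IsLCTRS S R →
           Theory.LCTRS.AlmostDevClosed S R →
           Theory.TRS.AlmostDevClosed S (Theory.LCTRS.Rbar S R)
theorem5 = AlmostDevClosed-Rbar
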